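{- For a positive integer $s$ and a nonnegative integer $r$, \[ \sum_{D \in \mathcal{E}_{s}^{(r)}} q^{\mathrm{vmr}(D)} = q^{\binom{r+1}{2}}\frac{1-q^{r+1}}{1-q^s} \begin{bmatrix} 2s\\ s+r+1\end{bmatrix}_q. \]
   Context: A Dyck path of length $2s$ is a sequence of lattice points $v_0=(0,0),v_1,\dots,v_{2s}=(2s,0)$ with each step in $\{(1,1),(1,-1)\}$, never going below the $x$-axis. A point $v_i$ ($0<i<2s$) is a valley if $v_i-v_{i-1}=(1,-1)$ and $v_{i+1}-v_i=(1,1)$; a valley on the $x$-axis is a return. Each return may independently be marked or not; $\mathcal{E}_s^{(r)}$ is the set of Dyck paths from $(0,0)$ to $(2s,0)$ together with a choice of exactly $r$ marked returns. $\mathrm{maj}(D)$ is the sum of the $x$-coordinates of all valleys of $D$, and $\mathrm{vmr}(D)=\mathrm{maj}(D)-\frac12\sum x_i$, the latter sum over the $x$-coordinates of the marked returns. $\begin{bmatrix} n\\ k\end{bmatrix}_q=\frac{(q;q)_n}{(q;q)_k(q;q)_{n-k}}$ for $n\ge k\ge0$ and $0$ otherwise, $(q;q)_n=(1-q)\cdots(1-q^n)$. -}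

module Defs where

open import Data.Bool using (Bool; true; false; if_then_else_; _∧_)
open import Data.Nat as ℕ using (ℕ; zero; suc; _∸_; _≤ᵇ_; _≡ᵇ_)
open import Data.Nat.DivMod using (_/_)
open import Data.Integer as ℤ using (ℤ; +_)
open import Data.List using (List; []; _∷_; map; concatMap; length; filter; foldr)
open import Data.Nat.ListAction using (sum)
open import Relation.Binary.PropositionalEquality using (_≡_)

-- Polynomials in q with integer coefficients, as coefficient lists
-- (constant term first).

Poly : Set
Poly = List ℤ

coeff : Poly → ℕ → ℤ
coeff []       _       = + 0
coeff (a ∷ p)  zero    = a
coeff (a ∷ p)  (suc i) = coeff p i

-- equality of polynomials (coefficientwise; trailing zeros irrelevant)
infix 4 _≈ₚ_
_≈ₚ_ : Poly → Poly → Set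
p ≈ₚ r = ∀ i → coeff p i ≡ coeff r i

infixl 6 _+ₚ_ _-ₚ_
infixl 7 _*ₚ_

_+ₚ_ : Poly → Poly → Poly
[]      +ₚ r       = r
(a ∷ p) +ₚ []      = a ∷ p
(a ∷ p) +ₚ (b ∷ r) = (a ℤ.+ b) ∷ (p +ₚ r)

scale : ℤ → Poly → Poly
scale c = map (c ℤ.*_)

_*ₚ_ : Poly → Poly → Poly
[]      *ₚ r = []
(a ∷ p) *ₚ r = scale a r +ₚ (+ 0 ∷ (p *ₚ r))

negₚ : Poly → Poly
negₚ = scale (ℤ.- (+ 1))

_-ₚ_ : Poly → Poly → Poly
p -ₚ r = p +ₚ negₚ r

0ₚ 1ₚ : Poly
0ₚ = []
1ₚ = + 1 ∷ []

qpow : ℕ → Poly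
qpow zero    = 1ₚ
qpow (suc k) = + 0 ∷ qpow k

qPoch : ℕ → Poly
qPoch zero    = 1ₚ
qPoch (suc n) = qPoch n *ₚ (1ₚ -ₚ qpow (suc n))

-- Rational functions in q as fractions numerator / denominator, with
-- equality in the field of fractions of ℤ[q].

record Frac : Set where
  constructor _⁄_
  field
    num : Poly
    den : Poly
open Frac public

infix 4 _≈f_
_≈f_ : Frac → Frac → Set
x ≈f y = num x *ₚ den y ≈ₚ num y *ₚ den x

infixl 7 _*f_
_*f_ : Frac → Frac → Frac
x *f y = (num x *ₚ num y) ⁄ (den x *ₚ den y)

poly : Poly → Frac
poly p = p ⁄ 1ₚ

qbinom : ℕ → ℕ → Frac
qbinom n k = if k ≤ᵇ n
             then qPoch n ⁄ (qPoch k *ₚ qPoch (n ∸ k))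
             else 0ₚ ⁄ 1ₚ

-- Dyck paths.  A path of length n is its list of steps:
-- true = up step (1,1), false = down step (1,-1).  Step number i
-- (1-indexed) is v_i - v_{i-1}.

allSeqs : ℕ → List (List Bool)
allSeqs zero    = [] ∷ []
allSeqs (suc n) = concatMap (λ w → (true ∷ w) ∷ (false ∷ w) ∷ []) (allSeqs n)

dyckFrom : ℕ → List Bool → Bool
dyckFrom h       []          = h ≡ᵇ 0
dyckFrom h       (true ∷ w)  = dyckFrom (suc h) w
dyckFrom zero    (false ∷ w) = false
dyckFrom (suc h) (false ∷ w) = dyckFrom h w

isDyck : List Bool → Bool
isDyck = dyckFrom 0

dyckPaths : ℕ → List (List Bool)
dyckPaths s = filter (λ w → isDyck w Data.Bool.≟ true) (allSeqs (2 ℕ.* s))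
  where import Data.Bool

-- valleysFrom i h w : the valleys, as pairs (x-coordinate, height), of the
-- remaining path w, given that the current point is v_i at height h.
-- v_i is a valley iff step i is down and step i+1 is up; we track whether
-- the previous step was down.
record Pt : Set where
  constructor pt
  field
    xc : ℕ
    yc : ℕ
open Pt public

valleysFrom : Bool → ℕ → ℕ → List Bool → List Pt
valleysFrom prevDown i h []          = []
valleysFrom prevDown i h (true ∷ w)  =
  let rest = valleysFrom false (suc i) (suc h) w in
  if prevDown then pt i h ∷ rest else rest
valleysFrom prevDown i h (false ∷ w) = valleysFrom true (suc i) (h ∸ 1) w

valleys : List Bool → List Pt
valleys = valleysFrom false 0 0

maj : List Bool → ℕ
maj D = sum (map xc (valleys D))

returns : List Bool → List ℕ
returns D = map xc (filter (λ p → yc p ℕ.≟ 0) (valleys D))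

choose : {A : Set} → ℕ → List A → List (List A)
choose zero    _       = [] ∷ []
choose (suc r) []      = []
choose (suc r) (a ∷ l) = map (a ∷_) (choose r l) ++ choose (suc r) l
  where open Data.List using (_++_)

-- E_s^(r): Dyck paths of length 2s with exactly r marked returns;
-- an element is (D , list of x-coordinates of the marked returns).
record Marked : Set where
  constructor _,ₘ_
  field
    path   : List Bool
    marked : List ℕ
open Marked public

E : ℕ → ℕ → List Marked
E s r = concatMap (λ D → map (D ,ₘ_) (choose r (returns D))) (dyckPaths s)

-- vmr(D) = maj(D) - (1/2) Σ x_i over marked returns.
-- (Return x-coordinates are even and the marked returns are among the
-- valleys, so the halving and the subtraction are exact.)
vmr : Marked → ℕ
vmr m = maj (path m) ∸ (sum (marked m) / 2)

vmrGF : ℕ → ℕ → Poly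
vmrGF s r = foldr (λ m acc → qpow (vmr m) +ₚ acc) 0ₚ (E s r)

module Submission where

-- The proof is a transfer-matrix computation.  A path with valley list V
-- contributes markedWeight r V = Σ over r-sets c of returns of q^(maj V - Σc/2).
-- A prefix of a step sequence is summarised by its tip (still admissible?,
-- current height h, last step down?), and prefixGF r n h d is the weighted
-- count of the admissible prefixes of length n with tip (h, d).  Appending a
-- step to a prefix of length n either creates no valley, a valley at height
-- h > 0 (factor q^n) or a return at n = 2j, which may also be marked (extra
-- term q^j with one mark fewer); this yields linear recurrences for prefixGF,
-- and the theorem's sum is the value of prefixGF at length 2s and height 0.
-- The recurrences are solved in closed form by Gaussian binomials (proved by
-- induction on n); for r < s the closed form at (2s, 0) is converted into the
-- stated rational function with the two q-Pascal rules and the factorial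
-- formula for [n, k]_q, while for r ≥ s both sides vanish.

open import Defs
open import Level using (0ℓ)
open import Data.Nat as ℕ using (ℕ; zero; suc; _+_; _*_; _∸_; _≤_; _<_; _≤ᵇ_; _≡ᵇ_; s≤s; z≤n)
import Data.Nat.Properties as ℕP
open import Data.Nat.Combinatorics using (_C_; nC1≡n; nCk+nC[k+1]≡[n+1]C[k+1])
open import Data.Nat.DivMod using (_/_; m/n≤m; m*n/n≡m; +-distrib-/-∣ʳ)
open import Data.Nat.Divisibility using (divides-refl)
open import Data.Nat.ListAction using (sum)
open import Data.Nat.ListAction.Properties using (sum-++)
open import Data.Nat.Tactic.RingSolver using () renaming (solve-∀ to ℕ-solve)
open import Data.Integer as ℤ using (+_)
import Data.Integer.Properties as ℤP
open import Data.Integer.Tactic.RingSolver using () renaming (solve-∀ to ℤ-solve)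
open import Data.Bool as Bool using (Bool; true; false; _∧_; if_then_else_; T)
open import Data.Empty using (⊥-elim)
open import Data.Unit using (tt)
open import Data.Maybe using (Maybe; just; nothing)
open import Data.Product using (_,_)
open import Data.List using (List; []; _∷_; _++_; _∷ʳ_; map; concatMap; filter; foldr; foldl; length)
open import Data.List.Properties using (foldl-∷ʳ; ++-identityʳ; filter-++; map-++)
open import Data.List.Relation.Unary.All as All using (All; []; _∷_)
open import Data.List.Relation.Unary.All.Properties using (++⁺; map⁺)
open import Relation.Nullary using (Dec; does; yes; no)
open import Relation.Unary using (Pred)
open import Relation.Binary.PropositionalEquality
  using (_≡_; refl; sym; trans; cong; cong₂; subst; module ≡-Reasoning)
import Relation.Binary.Reasoning.Setoid as SetoidReasoning
open import Algebra.Bundles using (CommutativeRing)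
open import Tactic.RingSolver using (solve-∀)
open import Tactic.RingSolver.Core.AlmostCommutativeRing
  using (AlmostCommutativeRing; fromCommutativeRing)

coeff-+ : ∀ p r i → coeff (p +ₚ r) i ≡ coeff p i ℤ.+ coeff r i
coeff-+ []      r       i       = sym (ℤP.+-identityˡ _)
coeff-+ (a ∷ p) []      i       = sym (ℤP.+-identityʳ _)
coeff-+ (a ∷ p) (b ∷ r) zero    = refl
coeff-+ (a ∷ p) (b ∷ r) (suc i) = coeff-+ p r i

coeff-scale : ∀ c p i → coeff (scale c p) i ≡ c ℤ.* coeff p i
coeff-scale c []      i       = sym (ℤP.*-zeroʳ c)
coeff-scale c (a ∷ p) zero    = refl
coeff-scale c (a ∷ p) (suc i) = coeff-scale c p i

-- Coefficientwise equality wrapped in a record, so that the two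
-- polynomials can be inferred from an equality proof.
infix 4 _≋_
record _≋_ (p r : Poly) : Set where
  constructor mk≋
  field coeff-≡ : p ≈ₚ r
open _≋_ public

≋-refl : ∀ {p} → p ≋ p
≋-refl = mk≋ λ i → refl

≋-sym : ∀ {p r} → p ≋ r → r ≋ p
≋-sym e = mk≋ λ i → sym (coeff-≡ e i)

≋-trans : ∀ {p r t} → p ≋ r → r ≋ t → p ≋ t
≋-trans e f = mk≋ λ i → trans (coeff-≡ e i) (coeff-≡ f i)

≋-reflexive : ∀ {p r} → p ≡ r → p ≋ r
≋-reflexive refl = ≋-refl

∷-cong : ∀ {a b p r} → a ≡ b → p ≋ r → (a ∷ p) ≋ (b ∷ r)
∷-cong {a} {b} {p} {r} a≡b p≋r = mk≋ coeffs
  where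
  coeffs : (a ∷ p) ≈ₚ (b ∷ r)
  coeffs zero    = a≡b
  coeffs (suc i) = coeff-≡ p≋r i

∷-head : ∀ {a b p r} → (a ∷ p) ≋ (b ∷ r) → a ≡ b
∷-head e = coeff-≡ e zero

∷-tail : ∀ {a b p r} → (a ∷ p) ≋ (b ∷ r) → p ≋ r
∷-tail e = mk≋ λ i → coeff-≡ e (suc i)

[]≋∷ : ∀ {a p} → + 0 ≡ a → [] ≋ p → [] ≋ (a ∷ p)
[]≋∷ {a} {p} 0≡a []≋p = mk≋ coeffs
  where
  coeffs : [] ≈ₚ (a ∷ p)
  coeffs zero    = 0≡a
  coeffs (suc i) = coeff-≡ []≋p i

+-cong : ∀ {p p' r r'} → p ≋ p' → r ≋ r' → (p +ₚ r) ≋ (p' +ₚ r')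
+-cong {p} {p'} {r} {r'} e f = mk≋ λ i → begin
  coeff (p +ₚ r) i            ≡⟨ coeff-+ p r i ⟩
  coeff p i ℤ.+ coeff r i     ≡⟨ cong₂ ℤ._+_ (coeff-≡ e i) (coeff-≡ f i) ⟩
  coeff p' i ℤ.+ coeff r' i   ≡⟨ coeff-+ p' r' i ⟨
  coeff (p' +ₚ r') i          ∎
  where open ≡-Reasoning

+-comm : ∀ p r → (p +ₚ r) ≋ (r +ₚ p)
+-comm p r = mk≋ λ i → begin
  coeff (p +ₚ r) i          ≡⟨ coeff-+ p r i ⟩
  coeff p i ℤ.+ coeff r i   ≡⟨ ℤP.+-comm (coeff p i) _ ⟩
  coeff r i ℤ.+ coeff p i   ≡⟨ coeff-+ r p i ⟨
  coeff (r +ₚ p) i          ∎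
  where open ≡-Reasoning

+-assoc : ∀ p r t → ((p +ₚ r) +ₚ t) ≋ (p +ₚ (r +ₚ t))
+-assoc p r t = mk≋ λ i → begin
  coeff ((p +ₚ r) +ₚ t) i                   ≡⟨ coeff-+ (p +ₚ r) t i ⟩
  coeff (p +ₚ r) i ℤ.+ coeff t i            ≡⟨ cong (ℤ._+ coeff t i) (coeff-+ p r i) ⟩
  coeff p i ℤ.+ coeff r i ℤ.+ coeff t i     ≡⟨ ℤP.+-assoc (coeff p i) _ _ ⟩
  coeff p i ℤ.+ (coeff r i ℤ.+ coeff t i)   ≡⟨ cong (λ z → coeff p i ℤ.+ z) (coeff-+ r t i) ⟨
  coeff p i ℤ.+ coeff (r +ₚ t) i            ≡⟨ coeff-+ p (r +ₚ t) i ⟨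
  coeff (p +ₚ (r +ₚ t)) i                   ∎
  where open ≡-Reasoning

+-identityʳ : ∀ p → (p +ₚ []) ≋ p
+-identityʳ p = mk≋ λ i → trans (coeff-+ p [] i) (ℤP.+-identityʳ _)

-‿inverseˡ : ∀ p → (negₚ p +ₚ p) ≋ []
-‿inverseˡ p = mk≋ λ i → begin
  coeff (negₚ p +ₚ p) i                      ≡⟨ coeff-+ (negₚ p) p i ⟩
  coeff (negₚ p) i ℤ.+ coeff p i             ≡⟨ cong (ℤ._+ coeff p i) (coeff-scale (ℤ.- + 1) p i) ⟩
  ℤ.- + 1 ℤ.* coeff p i ℤ.+ coeff p i        ≡⟨ cancel (coeff p i) ⟩
  + 0                                        ∎
  where
  open ≡-Reasoning
  cancel : ∀ x → ℤ.- + 1 ℤ.* x ℤ.+ x ≡ + 0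
  cancel = ℤ-solve

scale-cong : ∀ c {p r} → p ≋ r → scale c p ≋ scale c r
scale-cong c {p} {r} e = mk≋ λ i → begin
  coeff (scale c p) i   ≡⟨ coeff-scale c p i ⟩
  c ℤ.* coeff p i       ≡⟨ cong (λ z → c ℤ.* z) (coeff-≡ e i) ⟩
  c ℤ.* coeff r i       ≡⟨ coeff-scale c r i ⟨
  coeff (scale c r) i   ∎
  where open ≡-Reasoning

neg-cong : ∀ {p r} → p ≋ r → negₚ p ≋ negₚ r
neg-cong = scale-cong (ℤ.- + 1)

scale-distribˡ : ∀ c p r → scale c (p +ₚ r) ≋ (scale c p +ₚ scale c r)
scale-distribˡ c p r = mk≋ λ i → begin
  coeff (scale c (p +ₚ r)) i                    ≡⟨ coeff-scale c (p +ₚ r) i ⟩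
  c ℤ.* coeff (p +ₚ r) i                        ≡⟨ cong (λ z → c ℤ.* z) (coeff-+ p r i) ⟩
  c ℤ.* (coeff p i ℤ.+ coeff r i)               ≡⟨ ℤP.*-distribˡ-+ c (coeff p i) _ ⟩
  c ℤ.* coeff p i ℤ.+ c ℤ.* coeff r i           ≡⟨ cong₂ ℤ._+_ (coeff-scale c p i) (coeff-scale c r i) ⟨
  coeff (scale c p) i ℤ.+ coeff (scale c r) i   ≡⟨ coeff-+ (scale c p) _ i ⟨
  coeff (scale c p +ₚ scale c r) i              ∎
  where open ≡-Reasoning

scale-distribʳ : ∀ a b p → scale (a ℤ.+ b) p ≋ (scale a p +ₚ scale b p)
scale-distribʳ a b p = mk≋ λ i → begin
  coeff (scale (a ℤ.+ b) p) i                   ≡⟨ coeff-scale (a ℤ.+ b) p i ⟩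
  (a ℤ.+ b) ℤ.* coeff p i                       ≡⟨ ℤP.*-distribʳ-+ (coeff p i) a b ⟩
  a ℤ.* coeff p i ℤ.+ b ℤ.* coeff p i           ≡⟨ cong₂ ℤ._+_ (coeff-scale a p i) (coeff-scale b p i) ⟨
  coeff (scale a p) i ℤ.+ coeff (scale b p) i   ≡⟨ coeff-+ (scale a p) _ i ⟨
  coeff (scale a p +ₚ scale b p) i              ∎
  where open ≡-Reasoning

scale-assoc : ∀ a b p → scale a (scale b p) ≋ scale (a ℤ.* b) p
scale-assoc a b p = mk≋ λ i → begin
  coeff (scale a (scale b p)) i   ≡⟨ coeff-scale a (scale b p) i ⟩
  a ℤ.* coeff (scale b p) i       ≡⟨ cong (λ z → a ℤ.* z) (coeff-scale b p i) ⟩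
  a ℤ.* (b ℤ.* coeff p i)         ≡⟨ ℤP.*-assoc a b (coeff p i) ⟨
  a ℤ.* b ℤ.* coeff p i           ≡⟨ coeff-scale (a ℤ.* b) p i ⟨
  coeff (scale (a ℤ.* b) p) i     ∎
  where open ≡-Reasoning

scale-zero : ∀ p → scale (+ 0) p ≋ []
scale-zero p = mk≋ λ i → trans (coeff-scale (+ 0) p i) (ℤP.*-zeroˡ (coeff p i))

scale-one : ∀ p → scale (+ 1) p ≋ p
scale-one p = mk≋ λ i → trans (coeff-scale (+ 1) p i) (ℤP.*-identityˡ (coeff p i))

+-interchange : ∀ a b c d → ((a +ₚ b) +ₚ (c +ₚ d)) ≋ ((a +ₚ c) +ₚ (b +ₚ d))
+-interchange a b c d = mk≋ λ i → begin
  coeff ((a +ₚ b) +ₚ (c +ₚ d)) i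
    ≡⟨ trans (coeff-+ (a +ₚ b) _ i) (cong₂ ℤ._+_ (coeff-+ a b i) (coeff-+ c d i)) ⟩
  (coeff a i ℤ.+ coeff b i) ℤ.+ (coeff c i ℤ.+ coeff d i)
    ≡⟨ swap (coeff a i) (coeff b i) (coeff c i) (coeff d i) ⟩
  (coeff a i ℤ.+ coeff c i) ℤ.+ (coeff b i ℤ.+ coeff d i)
    ≡⟨ trans (coeff-+ (a +ₚ c) _ i) (cong₂ ℤ._+_ (coeff-+ a c i) (coeff-+ b d i)) ⟨
  coeff ((a +ₚ c) +ₚ (b +ₚ d)) i   ∎
  where
  open ≡-Reasoning
  swap : ∀ a b c d → (a ℤ.+ b) ℤ.+ (c ℤ.+ d) ≡ (a ℤ.+ c) ℤ.+ (b ℤ.+ d)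
  swap = ℤ-solve

*-zeroˡ : ∀ p r → [] ≋ p → (p *ₚ r) ≋ []
*-zeroˡ []      r e = ≋-refl
*-zeroˡ (a ∷ p) r e with coeff-≡ e zero
... | refl = ≋-trans (+-cong (scale-zero r) (∷-cong refl (*-zeroˡ p r (mk≋ λ i → coeff-≡ e (suc i)))))
                     (≋-sym ([]≋∷ refl ≋-refl))

*-zeroʳ : ∀ p → (p *ₚ []) ≋ []
*-zeroʳ []      = ≋-refl
*-zeroʳ (a ∷ p) = ≋-trans (∷-cong refl (*-zeroʳ p)) (≋-sym ([]≋∷ refl ≋-refl))

*-congˡ : ∀ {p p'} r → p ≋ p' → (p *ₚ r) ≋ (p' *ₚ r)
*-congˡ {[]}    {[]}     r e = ≋-refl
*-congˡ {[]}    {b ∷ p'} r e = ≋-sym (*-zeroˡ (b ∷ p') r e)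
*-congˡ {a ∷ p} {[]}     r e = *-zeroˡ (a ∷ p) r (≋-sym e)
*-congˡ {a ∷ p} {b ∷ p'} r e with ∷-head e
... | refl = +-cong ≋-refl (∷-cong refl (*-congˡ r (∷-tail e)))

*-congʳ : ∀ p {r r'} → r ≋ r' → (p *ₚ r) ≋ (p *ₚ r')
*-congʳ []      e = ≋-refl
*-congʳ (a ∷ p) e = +-cong (scale-cong a e) (∷-cong refl (*-congʳ p e))

*-cong : ∀ {p p' r r'} → p ≋ p' → r ≋ r' → (p *ₚ r) ≋ (p' *ₚ r')
*-cong {p} {p'} {r} e f = ≋-trans (*-congˡ r e) (*-congʳ p' f)

*-distribʳ : ∀ p p' r → ((p +ₚ p') *ₚ r) ≋ ((p *ₚ r) +ₚ (p' *ₚ r))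
*-distribʳ []      p'       r = ≋-refl
*-distribʳ (a ∷ p) []       r = ≋-sym (+-identityʳ _)
*-distribʳ (a ∷ p) (b ∷ p') r =
  ≋-trans (+-cong (scale-distribʳ a b r) (∷-cong refl (*-distribʳ p p' r)))
          (+-interchange (scale a r) (scale b r) (+ 0 ∷ (p *ₚ r)) (+ 0 ∷ (p' *ₚ r)))

*-distribˡ : ∀ p r r' → (p *ₚ (r +ₚ r')) ≋ ((p *ₚ r) +ₚ (p *ₚ r'))
*-distribˡ []      r r' = ≋-refl
*-distribˡ (a ∷ p) r r' =
  ≋-trans (+-cong (scale-distribˡ a r r') (∷-cong refl (*-distribˡ p r r')))
          (+-interchange (scale a r) (scale a r') (+ 0 ∷ (p *ₚ r)) (+ 0 ∷ (p *ₚ r')))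

shift-* : ∀ p r → ((+ 0 ∷ p) *ₚ r) ≋ (+ 0 ∷ (p *ₚ r))
shift-* p r = +-cong (scale-zero r) ≋-refl

scale-* : ∀ a r t → ((scale a r) *ₚ t) ≋ scale a (r *ₚ t)
scale-* a []      t = ≋-refl
scale-* a (b ∷ r) t =
  ≋-trans (+-cong (≋-sym (scale-assoc a b t)) (∷-cong refl (scale-* a r t)))
          (≋-sym (≋-trans (scale-distribˡ a (scale b t) (+ 0 ∷ (r *ₚ t)))
                          (+-cong ≋-refl (∷-cong (ℤP.*-zeroʳ a) ≋-refl))))

*-assoc : ∀ p r t → ((p *ₚ r) *ₚ t) ≋ (p *ₚ (r *ₚ t))
*-assoc []      r t = ≋-refl
*-assoc (a ∷ p) r t =
  ≋-trans (*-distribʳ (scale a r) (+ 0 ∷ (p *ₚ r)) t)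
          (+-cong (scale-* a r t) (≋-trans (shift-* (p *ₚ r) t) (∷-cong refl (*-assoc p r t))))

*-∷ʳ : ∀ p b r → (p *ₚ (b ∷ r)) ≋ (scale b p +ₚ (+ 0 ∷ (p *ₚ r)))
*-∷ʳ []      b r = []≋∷ refl ≋-refl
*-∷ʳ (a ∷ p) b r =
  ∷-cong (cong (ℤ._+ + 0) (ℤP.*-comm a b))
         (≋-trans (+-cong ≋-refl (*-∷ʳ p b r)) (exchange (scale a r) (scale b p) (+ 0 ∷ (p *ₚ r))))
  where
  exchange : ∀ x y z → (x +ₚ (y +ₚ z)) ≋ (y +ₚ (x +ₚ z))
  exchange x y z = ≋-trans (≋-sym (+-assoc x y z))
                           (≋-trans (+-cong (+-comm x y) ≋-refl) (+-assoc y x z))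

*-comm : ∀ p r → (p *ₚ r) ≋ (r *ₚ p)
*-comm []      r = ≋-sym (*-zeroʳ r)
*-comm (a ∷ p) r = ≋-trans (+-cong ≋-refl (∷-cong refl (*-comm p r))) (≋-sym (*-∷ʳ r a p))

*-identityˡ : ∀ p → (1ₚ *ₚ p) ≋ p
*-identityˡ p = ≋-trans (+-cong (scale-one p) (≋-sym ([]≋∷ refl ≋-refl))) (+-identityʳ p)

*-identityʳ : ∀ p → (p *ₚ 1ₚ) ≋ p
*-identityʳ p = ≋-trans (*-comm p 1ₚ) (*-identityˡ p)

polyRing : CommutativeRing _ _
polyRing = record
  { Carrier = Poly ; _≈_ = _≋_ ; _+_ = _+ₚ_ ; _*_ = _*ₚ_ ; -_ = negₚ ; 0# = [] ; 1# = 1ₚ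
  ; isCommutativeRing = record
    { isRing = record
      { +-isAbelianGroup = record
        { isGroup = record
          { isMonoid = record
            { isSemigroup = record
              { isMagma = record
                { isEquivalence = record
                  { refl = λ {x} → ≋-refl {x}
                  ; sym = λ {x} {y} → ≋-sym {x} {y}
                  ; trans = λ {x} {y} {z} → ≋-trans {x} {y} {z} }
                ; ∙-cong = λ {x} {y} {u} {v} → +-cong {x} {y} {u} {v} }
              ; assoc = +-assoc }
            ; identity = (λ p → ≋-refl) , +-identityʳ }
          ; inverse = -‿inverseˡ , (λ p → ≋-trans (+-comm p (negₚ p)) (-‿inverseˡ p))
          ; ⁻¹-cong = λ {x} {y} → neg-cong {x} {y} }
        ; comm = +-comm }
      ; *-cong = λ {x} {y} {u} {v} → *-cong {x} {y} {u} {v}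
      ; *-assoc = *-assoc
      ; *-identity = *-identityˡ , *-identityʳ
      ; distrib = *-distribˡ , (λ x y z → *-distribʳ y z x) }
    ; *-comm = *-comm } }

-- A (sound, incomplete) zero test, needed to run the ring solver.
isZero? : (p : Poly) → Maybe ([] ≋ p)
isZero? []           = just ≋-refl
isZero? (+ zero ∷ p) with isZero? p
... | just e  = just ([]≋∷ refl e)
... | nothing = nothing
isZero? (_ ∷ p)      = nothing

ℤ[q] : AlmostCommutativeRing _ _
ℤ[q] = fromCommutativeRing polyRing isZero?

open AlmostCommutativeRing ℤ[q] public
  using () renaming (_+_ to _⊕_; _*_ to _⊗_; -_ to ⊖_; 0# to 𝟘; 1# to 𝟙)

-- To prove L ≋ R from a known equation P ≋ Q it suffices to check the
-- ring identity L + Q ≋ R + P; combined with the ring solver this plays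
-- the role of a "linear combination" tactic.
linear-combination : ∀ {L R P Q} → (L +ₚ Q) ≋ (R +ₚ P) → P ≋ Q → L ≋ R
linear-combination {L} {R} {P} {Q} identity P≋Q =
  ≋-trans (add-sub L Q)
  (≋-trans (+-cong identity (≋-refl {negₚ Q}))
  (≋-trans (+-cong (+-cong (≋-refl {R}) P≋Q) (≋-refl {negₚ Q}))
           (≋-sym (add-sub R Q))))
  where
  add-sub : ∀ x y → x ≋ ((x ⊕ y) ⊕ ⊖ y)
  add-sub = solve-∀ ℤ[q]

module ≋-Reasoning = SetoidReasoning (CommutativeRing.setoid polyRing)

-- Powers of q as iterated products, so that the ring solver sees
-- q^(n+1) = q · q^n without any further hypothesis.
q : Poly
q = qpow 1

infix 10 q^_
q^_ : ℕ → Poly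
q^ zero  = 1ₚ
q^ suc n = q *ₚ q^ n

q-shift : ∀ p → q ⊗ p ≋ (+ 0 ∷ p)
q-shift p = ≋-trans (shift-* 1ₚ p) (∷-cong refl (*-identityˡ p))

q^≋qpow : ∀ n → q^ n ≋ qpow n
q^≋qpow zero    = ≋-refl
q^≋qpow (suc n) = ≋-trans (q-shift (q^ n)) (∷-cong refl (q^≋qpow n))

q^-+ : ∀ a b → q^ (a + b) ≋ q^ a ⊗ q^ b
q^-+ zero    b = ≋-sym (*-identityˡ (q^ b))
q^-+ (suc a) b = ≋-trans (*-congʳ q (q^-+ a b)) (≋-sym (*-assoc q (q^ a) (q^ b)))

q^-cong : ∀ {a b} → a ≡ b → q^ a ≋ q^ b
q^-cong refl = ≋-refl

one-minus-cong : ∀ {a b} → a ≋ b → 𝟙 ⊕ ⊖ a ≋ 𝟙 ⊕ ⊖ b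
one-minus-cong a≋b = +-cong (≋-refl {𝟙}) (neg-cong a≋b)

q^-cancel : ∀ a {p r} → q^ a ⊗ p ≋ q^ a ⊗ r → p ≋ r
q^-cancel zero    {p} {r} e = ≋-trans (≋-sym (*-identityˡ p)) (≋-trans e (*-identityˡ r))
q^-cancel (suc a) {p} {r} e = q^-cancel a (∷-tail (begin
  + 0 ∷ q^ a ⊗ p     ≈⟨ q-shift (q^ a ⊗ p) ⟨
  q ⊗ (q^ a ⊗ p)     ≈⟨ *-assoc q (q^ a) p ⟨
  q^ suc a ⊗ p       ≈⟨ e ⟩
  q^ suc a ⊗ r       ≈⟨ *-assoc q (q^ a) r ⟩
  q ⊗ (q^ a ⊗ r)     ≈⟨ q-shift (q^ a ⊗ r) ⟩
  + 0 ∷ q^ a ⊗ r     ∎))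
  where open ≋-Reasoning

gauss : ℕ → ℕ → Poly
gauss n       zero    = 1ₚ
gauss zero    (suc k) = []
gauss (suc n) (suc k) = gauss n k ⊕ q^ suc k ⊗ gauss n (suc k)

gaussPred : ℕ → ℕ → Poly
gaussPred n zero    = []
gaussPred n (suc k) = gauss n k

gauss-vanish : ∀ n k → n < k → gauss n k ≋ 𝟘
gauss-vanish zero    (suc k) _         = ≋-refl
gauss-vanish (suc n) (suc k) (s≤s n<k) =
  ≋-trans (+-cong (gauss-vanish n k n<k)
                  (*-congʳ (q^ suc k) (gauss-vanish n (suc k) (ℕP.m<n⇒m<1+n n<k))))
          (vanish (q^ suc k))
  where
  vanish : ∀ a → 𝟘 ⊕ a ⊗ 𝟘 ≋ 𝟘
  vanish = solve-∀ ℤ[q]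

gauss-diag : ∀ n → gauss n n ≋ 𝟙
gauss-diag zero    = ≋-refl
gauss-diag (suc n) =
  ≋-trans (+-cong (gauss-diag n) (*-congʳ (q^ suc n) (gauss-vanish n (suc n) (ℕP.n<1+n n))))
          (one-sum (q^ suc n))
  where
  one-sum : ∀ a → 𝟙 ⊕ a ⊗ 𝟘 ≋ 𝟙
  one-sum = solve-∀ ℤ[q]

pascal : ∀ n k → gauss (suc n) k ≋ gaussPred n k ⊕ q^ k ⊗ gauss n k
pascal n zero    = ≋-sym (*-identityˡ 1ₚ)
pascal n (suc k) = ≋-refl

-- The dual q-Pascal rule [m+1, k] = [m, k] + q^(m+1-k) [m, k-1], multiplied
-- through by q^k to avoid truncated subtraction.
dual-pascal : ∀ m k → q^ k ⊗ gauss (suc m) k ≋ q^ k ⊗ gauss m k ⊕ q^ suc m ⊗ gaussPred m k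
dual-pascal m zero = identity (q^ suc m)
  where
  identity : ∀ c → 𝟙 ⊗ 𝟙 ≋ 𝟙 ⊗ 𝟙 ⊕ c ⊗ 𝟘
  identity = solve-∀ ℤ[q]
dual-pascal zero (suc zero) = identity (q^ 1)
  where
  identity : ∀ a → a ⊗ (𝟙 ⊕ a ⊗ 𝟘) ≋ a ⊗ 𝟘 ⊕ a ⊗ 𝟙
  identity = solve-∀ ℤ[q]
dual-pascal zero (suc (suc k)) = identity (q^ suc (suc k)) (q^ 1)
  where
  identity : ∀ a b → a ⊗ (𝟘 ⊕ a ⊗ 𝟘) ≋ a ⊗ 𝟘 ⊕ b ⊗ 𝟘
  identity = solve-∀ ℤ[q]
dual-pascal (suc m) (suc k) = begin
  A ⊗ (U ⊕ A ⊗ V)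
    ≈⟨ expand q a U V ⟩
  q ⊗ (a ⊗ U) ⊕ A ⊗ (A ⊗ V)
    ≈⟨ +-cong (*-congʳ q (dual-pascal m k)) (*-congʳ A (dual-pascal m (suc k))) ⟩
  q ⊗ (a ⊗ P ⊕ b ⊗ R) ⊕ A ⊗ (A ⊗ Q ⊕ b ⊗ P)
    ≈⟨ regroup q a b P Q R ⟩
  A ⊗ V ⊕ (q ⊗ b) ⊗ (R ⊕ a ⊗ P)
    ≈⟨ +-cong (≋-refl {A ⊗ V}) (*-congʳ (q ⊗ b) (pascal m k)) ⟨
  A ⊗ V ⊕ (q ⊗ b) ⊗ U
    ∎
  where
  open ≋-Reasoning
  a = q^ k
  b = q^ suc m
  A = q^ suc k
  P = gauss m k
  Q = gauss m (suc k)
  R = gaussPred m k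
  U = gauss (suc m) k
  V = gauss (suc m) (suc k)
  expand : ∀ x a U V → (x ⊗ a) ⊗ (U ⊕ (x ⊗ a) ⊗ V) ≋ x ⊗ (a ⊗ U) ⊕ (x ⊗ a) ⊗ ((x ⊗ a) ⊗ V)
  expand = solve-∀ ℤ[q]
  regroup : ∀ x a b P Q R →
    x ⊗ (a ⊗ P ⊕ b ⊗ R) ⊕ (x ⊗ a) ⊗ ((x ⊗ a) ⊗ Q ⊕ b ⊗ P)
      ≋ (x ⊗ a) ⊗ (P ⊕ (x ⊗ a) ⊗ Q) ⊕ (x ⊗ b) ⊗ (R ⊕ a ⊗ P)
  regroup = solve-∀ ℤ[q]

-- Symmetry [a+b, a] = [a+b, b]: both Pascal rules expand the two sides
-- into the same pair of smaller coefficients.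
gauss-symm : ∀ a b → gauss (a + b) a ≋ gauss (a + b) b
gauss-symm zero    b = ≋-sym (gauss-diag b)
gauss-symm (suc a) zero rewrite ℕP.+-identityʳ a = gauss-diag (suc a)
gauss-symm (suc a) (suc b) = begin
  gauss N a ⊕ q^ suc a ⊗ gauss N (suc a)
    ≈⟨ +-cong (gauss-symm a (suc b)) (*-congʳ (q^ suc a) symm-shifted) ⟩
  gauss N (suc b) ⊕ q^ suc a ⊗ gauss N b
    ≈⟨ q^-cancel (suc b) dual-pascal-rearranged ⟨
  gauss (suc N) (suc b)
    ∎
  where
  open ≋-Reasoning
  N = a + suc b
  symm-shifted : gauss N (suc a) ≋ gauss N b
  symm-shifted = subst (λ n → gauss n (suc a) ≋ gauss n b) (sym (ℕP.+-suc a b)) (gauss-symm (suc a) b)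
  distribute : ∀ c d X Y → c ⊗ X ⊕ (c ⊗ d) ⊗ Y ≋ c ⊗ (X ⊕ d ⊗ Y)
  distribute = solve-∀ ℤ[q]
  dual-pascal-rearranged :
    q^ suc b ⊗ gauss (suc N) (suc b) ≋ q^ suc b ⊗ (gauss N (suc b) ⊕ q^ suc a ⊗ gauss N b)
  dual-pascal-rearranged = ≋-trans (dual-pascal N (suc b))
    (≋-trans (+-cong (≋-refl {q^ suc b ⊗ gauss N (suc b)})
                     (*-congˡ (gauss N b) (≋-trans (q^-cong (ℕP.+-comm (suc a) (suc b)))
                                                   (q^-+ (suc b) (suc a)))))
             (distribute (q^ suc b) (q^ suc a) (gauss N (suc b)) (gauss N b)))

-- The q-factorial formula [k+d, k] (q;q)_k (q;q)_d = (q;q)_(k+d), which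
-- identifies the Pascal polynomials with the quotient of q-Pochhammer
-- symbols used in the definition of qbinom.
gauss-factorial : ∀ k d → gauss (k + d) k ⊗ qPoch k ⊗ qPoch d ≋ qPoch (k + d)
gauss-factorial zero d = identity (qPoch d)
  where
  identity : ∀ P → 𝟙 ⊗ 𝟙 ⊗ P ≋ P
  identity = solve-∀ ℤ[q]
gauss-factorial (suc k) zero rewrite ℕP.+-identityʳ k =
  ≋-trans (*-congˡ 1ₚ (*-congˡ (qPoch (suc k)) (gauss-diag (suc k)))) (identity (qPoch (suc k)))
  where
  identity : ∀ P → 𝟙 ⊗ P ⊗ 𝟙 ≋ P
  identity = solve-∀ ℤ[q]
gauss-factorial (suc k) (suc d) = begin
  (B₁ ⊕ q^ suc k ⊗ B₂) ⊗ (Pk ⊗ (𝟙 ⊕ ⊖ a)) ⊗ (Pd ⊗ (𝟙 ⊕ ⊖ c))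
    ≈⟨ *-congˡ _ (*-congˡ _ (+-cong (≋-refl {B₁}) (*-congˡ B₂ (q^≋qpow (suc k))))) ⟩
  (B₁ ⊕ a ⊗ B₂) ⊗ (Pk ⊗ (𝟙 ⊕ ⊖ a)) ⊗ (Pd ⊗ (𝟙 ⊕ ⊖ c))
    ≈⟨ split B₁ B₂ Pk Pd a c ⟩
  (𝟙 ⊕ ⊖ a) ⊗ (B₁ ⊗ Pk ⊗ (Pd ⊗ (𝟙 ⊕ ⊖ c)))
    ⊕ (a ⊗ (𝟙 ⊕ ⊖ c)) ⊗ (B₂ ⊗ (Pk ⊗ (𝟙 ⊕ ⊖ a)) ⊗ Pd)
    ≈⟨ +-cong (*-congʳ (𝟙 ⊕ ⊖ a) (gauss-factorial k (suc d)))
              (*-congʳ (a ⊗ (𝟙 ⊕ ⊖ c)) factorial-shifted) ⟩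
  (𝟙 ⊕ ⊖ a) ⊗ Pn ⊕ (a ⊗ (𝟙 ⊕ ⊖ c)) ⊗ Pn
    ≈⟨ collect a c Pn ⟩
  Pn ⊗ (𝟙 ⊕ ⊖ (a ⊗ c))
    ≈⟨ *-congʳ Pn (one-minus-cong power) ⟨
  Pn ⊗ (𝟙 ⊕ ⊖ qpow (suc n))
    ∎
  where
  open ≋-Reasoning
  n  = k + suc d
  B₁ = gauss n k
  B₂ = gauss n (suc k)
  Pk = qPoch k
  Pd = qPoch d
  Pn = qPoch n
  a  = qpow (suc k)
  c  = qpow (suc d)
  factorial-shifted : B₂ ⊗ qPoch (suc k) ⊗ Pd ≋ Pn
  factorial-shifted = subst (λ m → gauss m (suc k) ⊗ qPoch (suc k) ⊗ Pd ≋ qPoch m)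
                            (sym (ℕP.+-suc k d)) (gauss-factorial (suc k) d)
  power : qpow (suc n) ≋ a ⊗ c
  power = ≋-trans (≋-sym (q^≋qpow (suc n)))
          (≋-trans (q^-+ (suc k) (suc d)) (*-cong (q^≋qpow (suc k)) (q^≋qpow (suc d))))
  split : ∀ B₁ B₂ Pk Pd a c →
    (B₁ ⊕ a ⊗ B₂) ⊗ (Pk ⊗ (𝟙 ⊕ ⊖ a)) ⊗ (Pd ⊗ (𝟙 ⊕ ⊖ c))
      ≋ (𝟙 ⊕ ⊖ a) ⊗ (B₁ ⊗ Pk ⊗ (Pd ⊗ (𝟙 ⊕ ⊖ c)))
          ⊕ (a ⊗ (𝟙 ⊕ ⊖ c)) ⊗ (B₂ ⊗ (Pk ⊗ (𝟙 ⊕ ⊖ a)) ⊗ Pd)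
  split = solve-∀ ℤ[q]
  collect : ∀ a c P → (𝟙 ⊕ ⊖ a) ⊗ P ⊕ (a ⊗ (𝟙 ⊕ ⊖ c)) ⊗ P ≋ P ⊗ (𝟙 ⊕ ⊖ (a ⊗ c))
  collect = solve-∀ ℤ[q]

Σ : {A : Set} → List A → (A → Poly) → Poly
Σ []       f = 𝟘
Σ (x ∷ xs) f = f x ⊕ Σ xs f

-- The value of an expression f r' at the predecessor r' of r, or 0 if r = 0.
-- It records the terms that exist only when at least one return is marked.
atPred : ℕ → (ℕ → Poly) → Poly
atPred zero    f = 𝟘
atPred (suc r) f = f r

module _ {A : Set} where

  Σ-congᴬ : ∀ {xs : List A} {f g} → All (λ x → f x ≋ g x) xs → Σ xs f ≋ Σ xs g
  Σ-congᴬ []       = ≋-refl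
  Σ-congᴬ (e ∷ es) = +-cong e (Σ-congᴬ es)

  Σ-cong : ∀ (xs : List A) {f g} → (∀ x → f x ≋ g x) → Σ xs f ≋ Σ xs g
  Σ-cong xs f≋g = Σ-congᴬ (All.universal f≋g xs)

  Σ-++ : ∀ (xs ys : List A) f → Σ (xs ++ ys) f ≋ Σ xs f ⊕ Σ ys f
  Σ-++ []       ys f = ≋-refl
  Σ-++ (x ∷ xs) ys f =
    ≋-trans (+-cong (≋-refl {f x}) (Σ-++ xs ys f)) (≋-sym (+-assoc (f x) (Σ xs f) (Σ ys f)))

  Σ-+ : ∀ (xs : List A) f g → Σ xs (λ x → f x ⊕ g x) ≋ Σ xs f ⊕ Σ xs g
  Σ-+ []       f g = ≋-refl
  Σ-+ (x ∷ xs) f g =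
    ≋-trans (+-cong (≋-refl {f x ⊕ g x}) (Σ-+ xs f g)) (+-interchange (f x) (g x) (Σ xs f) (Σ xs g))

  Σ-* : ∀ (xs : List A) c f → Σ xs (λ x → c ⊗ f x) ≋ c ⊗ Σ xs f
  Σ-* []       c f = ≋-sym (*-zeroʳ c)
  Σ-* (x ∷ xs) c f =
    ≋-trans (+-cong (≋-refl {c ⊗ f x}) (Σ-* xs c f)) (≋-sym (*-distribˡ c (f x) (Σ xs f)))

  Σ-zero : ∀ (xs : List A) → Σ xs (λ _ → 𝟘) ≋ 𝟘
  Σ-zero []       = ≋-refl
  Σ-zero (x ∷ xs) = Σ-zero xs

  Σ-atPred : ∀ (xs : List A) r (f : A → ℕ → Poly) →
             Σ xs (λ x → atPred r (f x)) ≋ atPred r (λ r' → Σ xs (λ x → f x r'))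
  Σ-atPred xs zero    f = Σ-zero xs
  Σ-atPred xs (suc r) f = ≋-refl

  Σ-map : ∀ {B : Set} (g : B → A) (xs : List B) f → Σ (map g xs) f ≡ Σ xs (λ x → f (g x))
  Σ-map g []       f = refl
  Σ-map g (x ∷ xs) f = cong (f (g x) ⊕_) (Σ-map g xs f)

  Σ-concatMap : ∀ {B : Set} (g : B → List A) (xs : List B) f →
                Σ (concatMap g xs) f ≋ Σ xs (λ x → Σ (g x) f)
  Σ-concatMap g []       f = ≋-refl
  Σ-concatMap g (x ∷ xs) f =
    ≋-trans (Σ-++ (g x) (concatMap g xs) f) (+-cong (≋-refl {Σ (g x) f}) (Σ-concatMap g xs f))

  Σ-foldr : ∀ (xs : List A) f → foldr (λ x acc → f x ⊕ acc) 𝟘 xs ≡ Σ xs f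
  Σ-foldr []       f = refl
  Σ-foldr (x ∷ xs) f = cong (f x ⊕_) (Σ-foldr xs f)

  Σ-filter : ∀ {P : Pred A 0ℓ} (P? : ∀ x → Dec (P x)) (xs : List A) f →
             Σ (filter P? xs) f ≋ Σ xs (λ x → if does (P? x) then f x else 𝟘)
  Σ-filter P? []       f = ≋-refl
  Σ-filter P? (x ∷ xs) f with does (P? x)
  ... | true  = +-cong (≋-refl {f x}) (Σ-filter P? xs f)
  ... | false = Σ-filter P? xs f


Σ-choose-∷ : ∀ {A : Set} r y (R : List A) f →
             Σ (choose r (y ∷ R)) f ≋ atPred r (λ r' → Σ (choose r' R) (λ c → f (y ∷ c))) ⊕ Σ (choose r R) f
Σ-choose-∷ zero    y R f = ≋-refl
Σ-choose-∷ (suc r) y R f =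
  ≋-trans (Σ-++ (map (y ∷_) (choose r R)) (choose (suc r) R) f)
          (+-cong (≋-reflexive (Σ-map (y ∷_) (choose r R) f)) (≋-refl {Σ (choose (suc r) R) f}))

Σ-choose-∷ʳ : ∀ {A : Set} r (R : List A) x f →
              Σ (choose r (R ∷ʳ x)) f ≋ Σ (choose r R) f ⊕ atPred r (λ r' → Σ (choose r' R) (λ c → f (c ∷ʳ x)))
Σ-choose-∷ʳ zero          R       x f = ≋-sym (+-identityʳ _)
Σ-choose-∷ʳ (suc zero)    []      x f = ≋-refl
Σ-choose-∷ʳ (suc (suc r)) []      x f = ≋-refl
Σ-choose-∷ʳ (suc r)       (y ∷ R) x f =
  ≋-trans (Σ-choose-∷ (suc r) y (R ∷ʳ x) f)
  (≋-trans (+-cong (Σ-choose-∷ʳ r R x (λ c → f (y ∷ c))) (Σ-choose-∷ʳ (suc r) R x f))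
  (≋-trans (+-interchange (Σ (choose r R) (λ c → f (y ∷ c)))
                          (atPred r (λ r' → Σ (choose r' R) (λ c → f (y ∷ c ∷ʳ x))))
                          (Σ (choose (suc r) R) f)
                          (Σ (choose r R) (λ c → f (c ∷ʳ x))))
           (≋-sym (+-cong (Σ-choose-∷ (suc r) y R f) (Σ-choose-∷ r y R (λ c → f (c ∷ʳ x)))))))

Σ-allSeqs-∷ : ∀ n f → Σ (allSeqs (suc n)) f ≋ Σ (allSeqs n) (λ w → f (true ∷ w) ⊕ f (false ∷ w))
Σ-allSeqs-∷ n f =
  ≋-trans (Σ-concatMap (λ w → (true ∷ w) ∷ (false ∷ w) ∷ []) (allSeqs n) f)
          (Σ-cong (allSeqs n) (λ w → +-cong (≋-refl {f (true ∷ w)}) (+-identityʳ (f (false ∷ w)))))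

Σ-allSeqs-∷ʳ : ∀ n f → Σ (allSeqs (suc n)) f ≋ Σ (allSeqs n) (λ w → f (w ∷ʳ true) ⊕ f (w ∷ʳ false))
Σ-allSeqs-∷ʳ zero    f = Σ-allSeqs-∷ zero f
Σ-allSeqs-∷ʳ (suc n) f =
  ≋-trans (Σ-allSeqs-∷ (suc n) f)
  (≋-trans (Σ-allSeqs-∷ʳ n (λ w → f (true ∷ w) ⊕ f (false ∷ w)))
  (≋-trans (Σ-cong (allSeqs n) (λ w → +-interchange (f (true ∷ w ∷ʳ true)) (f (false ∷ w ∷ʳ true))
                                                     (f (true ∷ w ∷ʳ false)) (f (false ∷ w ∷ʳ false))))
           (≋-sym (Σ-allSeqs-∷ n (λ w → f (w ∷ʳ true) ⊕ f (w ∷ʳ false))))))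

allSeqs-length : ∀ n → All (λ w → length w ≡ n) (allSeqs n)
allSeqs-length zero    = refl ∷ []
allSeqs-length (suc n) = concatMap⁺ (allSeqs-length n)
  where
  concatMap⁺ : ∀ {xs} → All (λ w → length w ≡ n) xs →
               All (λ w → length w ≡ suc n) (concatMap (λ w → (true ∷ w) ∷ (false ∷ w) ∷ []) xs)
  concatMap⁺ []       = []
  concatMap⁺ (e ∷ es) = cong suc e ∷ cong suc e ∷ concatMap⁺ es

record Tip : Set where
  constructor tip
  field
    ok     : Bool
    height : ℕ
    down   : Bool
open Tip public

-- One step; a down step from height 0 leaves the admissible region for
-- good (the height is then truncated to 0, as in valleysFrom).
move : Tip → Bool → Tip
move (tip ok h       d) true  = tip ok (suc h) false
move (tip ok zero    d) false = tip false zero true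
move (tip ok (suc h) d) false = tip ok h true

tipFrom : Tip → List Bool → Tip
tipFrom = foldl move

start : Tip
start = tip true 0 false

tipOf : List Bool → Tip
tipOf = tipFrom start

tipOf-∷ʳ : ∀ w b → tipOf (w ∷ʳ b) ≡ move (tipOf w) b
tipOf-∷ʳ w b = foldl-∷ʳ move start b w

closed : Tip → Bool
closed (tip ok h d) = ok ∧ (h ≡ᵇ 0)

closed-failed : ∀ h d w → closed (tipFrom (tip false h d) w) ≡ false
closed-failed h       d []          = refl
closed-failed h       d (true ∷ w)  = closed-failed (suc h) false w
closed-failed zero    d (false ∷ w) = closed-failed zero true w
closed-failed (suc h) d (false ∷ w) = closed-failed h true w

dyckFrom-closed : ∀ h d w → dyckFrom h w ≡ closed (tipFrom (tip true h d) w)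
dyckFrom-closed h       d []          = refl
dyckFrom-closed h       d (true ∷ w)  = dyckFrom-closed (suc h) false w
dyckFrom-closed zero    d (false ∷ w) = sym (closed-failed zero true w)
dyckFrom-closed (suc h) d (false ∷ w) = dyckFrom-closed h true w

isDyck-closed : ∀ w → isDyck w ≡ closed (tipOf w)
isDyck-closed = dyckFrom-closed 0 false

newValley : Tip → ℕ → Bool → List Pt → List Pt
newValley t                x false V = V
newValley (tip ok h false) x true  V = V
newValley (tip ok h true)  x true  V = V ∷ʳ pt x h

newValley-∷ : ∀ t x b p V → newValley t x b (p ∷ V) ≡ p ∷ newValley t x b V
newValley-∷ (tip ok h true)  x true  p V = refl
newValley-∷ (tip ok h false) x true  p V = refl
newValley-∷ (tip ok h d)     x false p V = refl

valleysFrom-∷ʳ : ∀ ok d i h w b →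
  valleysFrom d i h (w ∷ʳ b) ≡ newValley (tipFrom (tip ok h d) w) (i + length w) b (valleysFrom d i h w)
valleysFrom-∷ʳ ok true  i h [] true  rewrite ℕP.+-identityʳ i = refl
valleysFrom-∷ʳ ok false i h [] true  = refl
valleysFrom-∷ʳ ok d     i h [] false = refl
valleysFrom-∷ʳ ok d i h (true ∷ w) b
  rewrite valleysFrom-∷ʳ ok false (suc i) (suc h) w b | ℕP.+-suc i (length w) with d
... | true  = sym (newValley-∷ (tipFrom (tip ok (suc h) false) w) (suc (i + length w)) b (pt i h) _)
... | false = refl
valleysFrom-∷ʳ ok d i zero (false ∷ w) b
  rewrite valleysFrom-∷ʳ false true (suc i) zero w b | ℕP.+-suc i (length w) = refl
valleysFrom-∷ʳ ok d i (suc h) (false ∷ w) b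
  rewrite valleysFrom-∷ʳ ok true (suc i) h w b | ℕP.+-suc i (length w) = refl

valleys-∷ʳ : ∀ w b → valleys (w ∷ʳ b) ≡ newValley (tipOf w) (length w) b (valleys w)
valleys-∷ʳ = valleysFrom-∷ʳ true false 0 0

isReturn : (p : Pt) → Dec (yc p ≡ 0)
isReturn p = yc p ℕ.≟ 0

returnsOf : List Pt → List ℕ
returnsOf V = map xc (filter isReturn V)

majOf : List Pt → ℕ
majOf V = sum (map xc V)

markedWeight : ℕ → List Pt → Poly
markedWeight r V = Σ (choose r (returnsOf V)) (λ c → q^ (majOf V ∸ sum c / 2))

returnsOf-valley : ∀ V x y → returnsOf (V ∷ʳ pt x (suc y)) ≡ returnsOf V
returnsOf-valley V x y
  rewrite filter-++ isReturn V (pt x (suc y) ∷ []) | ++-identityʳ (filter isReturn V) = refl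

returnsOf-return : ∀ V x → returnsOf (V ∷ʳ pt x 0) ≡ returnsOf V ∷ʳ x
returnsOf-return V x rewrite filter-++ isReturn V (pt x 0 ∷ []) = map-++ xc (filter isReturn V) (pt x 0 ∷ [])

majOf-∷ʳ : ∀ V x y → majOf (V ∷ʳ pt x y) ≡ majOf V + x
majOf-∷ʳ V x y rewrite map-++ xc V (pt x y ∷ []) | sum-++ (map xc V) (x ∷ []) | ℕP.+-identityʳ x = refl

-- Every marked set weighs at most maj, so the subtraction in the exponent
-- never truncates.
sum-choose-≤ : ∀ r R → All (λ c → sum c ≤ sum R) (choose r R)
sum-choose-≤ zero    R       = z≤n ∷ []
sum-choose-≤ (suc r) []      = []
sum-choose-≤ (suc r) (y ∷ R) =
  ++⁺ (map⁺ (All.map (ℕP.+-monoʳ-≤ y) (sum-choose-≤ r R)))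
      (All.map (λ c≤R → ℕP.≤-trans c≤R (ℕP.m≤n+m (sum R) y)) (sum-choose-≤ (suc r) R))

returns-≤-maj : ∀ V → sum (returnsOf V) ≤ majOf V
returns-≤-maj []      = z≤n
returns-≤-maj (p ∷ V) with does (isReturn p)
... | true  = ℕP.+-monoʳ-≤ (xc p) (returns-≤-maj V)
... | false = ℕP.≤-trans (returns-≤-maj V) (ℕP.m≤n+m _ (xc p))

marked-≤-maj : ∀ r V → All (λ c → sum c / 2 ≤ majOf V) (choose r (returnsOf V))
marked-≤-maj r V =
  All.map (λ c≤R → ℕP.≤-trans (m/n≤m _ 2) (ℕP.≤-trans c≤R (returns-≤-maj V))) (sum-choose-≤ r (returnsOf V))

Σ-q^-shift : ∀ {A : Set} (cs : List A) (t : A → ℕ) M k → All (λ c → t c ≤ M) cs →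
             Σ cs (λ c → q^ ((M + k) ∸ t c)) ≋ q^ k ⊗ Σ cs (λ c → q^ (M ∸ t c))
Σ-q^-shift cs t M k bounds =
  ≋-trans (Σ-congᴬ (All.map shift bounds)) (Σ-* cs (q^ k) (λ c → q^ (M ∸ t c)))
  where
  shift : ∀ {c} → t c ≤ M → q^ ((M + k) ∸ t c) ≋ q^ k ⊗ q^ (M ∸ t c)
  shift {c} t≤M = ≋-trans (q^-cong (ℕP.+-∸-comm k t≤M))
                          (≋-trans (q^-+ (M ∸ t c) k) (*-comm (q^ (M ∸ t c)) (q^ k)))

weight-valley : ∀ r V x y → markedWeight r (V ∷ʳ pt x (suc y)) ≋ q^ x ⊗ markedWeight r V
weight-valley r V x y rewrite returnsOf-valley V x y | majOf-∷ʳ V x (suc y) =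
  Σ-q^-shift (choose r (returnsOf V)) (λ c → sum c / 2) (majOf V) x (marked-≤-maj r V)

half-+ : ∀ a j → (a + (j + j)) / 2 ≡ a / 2 + j
half-+ a j = begin
  (a + (j + j)) / 2   ≡⟨ cong (λ m → (a + m) / 2) (double j) ⟩
  (a + j ℕ.* 2) / 2   ≡⟨ +-distrib-/-∣ʳ a (divides-refl j) ⟩
  a / 2 + j ℕ.* 2 / 2 ≡⟨ cong (λ m → a / 2 + m) (m*n/n≡m j 2) ⟩
  a / 2 + j           ∎
  where
  open ≡-Reasoning
  double : ∀ j → j + j ≡ j ℕ.* 2
  double = ℕ-solve

exponent-+ : ∀ M t j → t ≤ M → (M + (j + j)) ∸ (t + j) ≡ (M ∸ t) + j
exponent-+ M t j t≤M = begin
  (M + (j + j)) ∸ (t + j)     ≡⟨ ℕP.∸-+-assoc (M + (j + j)) t j ⟨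
  (M + (j + j)) ∸ t ∸ j       ≡⟨ cong (_∸ j) (ℕP.+-∸-comm (j + j) t≤M) ⟩
  (M ∸ t) + (j + j) ∸ j       ≡⟨ cong (_∸ j) (ℕP.+-assoc (M ∸ t) j j) ⟨
  (M ∸ t) + j + j ∸ j         ≡⟨ ℕP.m+n∸n≡m ((M ∸ t) + j) j ⟩
  (M ∸ t) + j                 ∎
  where open ≡-Reasoning

atPred-cong : ∀ r {f g} → (∀ r' → f r' ≋ g r') → atPred r f ≋ atPred r g
atPred-cong zero    f≋g = ≋-refl
atPred-cong (suc r) f≋g = f≋g r

-- A new return at position 2j: the old marked sets gain q^(2j); the sets
-- that mark the new return consist of r-1 old returns, and marking it
-- costs q^(2j) · q^(-j).
weight-return : ∀ r V j →
  markedWeight r (V ∷ʳ pt (j + j) 0) ≋ q^ (j + j) ⊗ markedWeight r V ⊕ atPred r (λ r' → q^ j ⊗ markedWeight r' V)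
weight-return r V j rewrite returnsOf-return V (j + j) | majOf-∷ʳ V (j + j) 0 =
  ≋-trans (Σ-choose-∷ʳ r (returnsOf V) (j + j) (λ c → q^ ((majOf V + (j + j)) ∸ sum c / 2)))
          (+-cong (Σ-q^-shift (choose r (returnsOf V)) (λ c → sum c / 2) (majOf V) (j + j) (marked-≤-maj r V))
                  (atPred-cong r marking-new-return))
  where
  marking-new-return : ∀ r' →
    Σ (choose r' (returnsOf V)) (λ c → q^ ((majOf V + (j + j)) ∸ sum (c ∷ʳ (j + j)) / 2))
      ≋ q^ j ⊗ markedWeight r' V
  marking-new-return r' =
    ≋-trans (Σ-congᴬ (All.map (λ {c} → exponent {c}) (marked-≤-maj r' V)))
            (Σ-* (choose r' (returnsOf V)) (q^ j) (λ c → q^ (majOf V ∸ sum c / 2)))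
    where
    exponent : ∀ {c} → sum c / 2 ≤ majOf V →
               q^ ((majOf V + (j + j)) ∸ sum (c ∷ʳ (j + j)) / 2) ≋ q^ j ⊗ q^ (majOf V ∸ sum c / 2)
    exponent {c} bound
      rewrite sum-++ c ((j + j) ∷ []) | ℕP.+-identityʳ (j + j) | half-+ (sum c) j
            | exponent-+ (majOf V) (sum c / 2) j bound =
      ≋-trans (q^-+ (majOf V ∸ sum c / 2) j) (*-comm (q^ (majOf V ∸ sum c / 2)) (q^ j))

endsAt : ℕ → Bool → Tip → Bool
endsAt h d (tip ok h' d') = ok ∧ does (d' Bool.≟ d) ∧ (h' ≡ᵇ h)

stateWeight : ℕ → ℕ → Bool → Tip → List Pt → Poly
stateWeight r h d t V = if endsAt h d t then markedWeight r V else 𝟘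

prefixGF : ℕ → ℕ → ℕ → Bool → Poly
prefixGF r n h d = Σ (allSeqs n) (λ w → stateWeight r h d (tipOf w) (valleys w))

extensions : ℕ → ℕ → Bool → Tip → List Pt → ℕ → Poly
extensions r h d t V x =
  stateWeight r h d (move t true) (newValley t x true V)
    ⊕ stateWeight r h d (move t false) (newValley t x false V)

transfer : ∀ r n h d (F : Tip → List Pt → Poly) → (∀ t V → extensions r h d t V n ≋ F t V) →
           prefixGF r (suc n) h d ≋ Σ (allSeqs n) (λ w → F (tipOf w) (valleys w))
transfer r n h d F step =
  ≋-trans (Σ-allSeqs-∷ʳ n (λ w → stateWeight r h d (tipOf w) (valleys w)))
          (Σ-congᴬ (All.map (λ {w} → extend w) (allSeqs-length n)))
  where
  extend : ∀ w → length w ≡ n →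
           stateWeight r h d (tipOf (w ∷ʳ true)) (valleys (w ∷ʳ true))
             ⊕ stateWeight r h d (tipOf (w ∷ʳ false)) (valleys (w ∷ʳ false))
           ≋ F (tipOf w) (valleys w)
  extend w refl rewrite tipOf-∷ʳ w true | tipOf-∷ʳ w false | valleys-∷ʳ w true | valleys-∷ʳ w false =
    step (tipOf w) (valleys w)

-- Appending a
-- down step never creates a valley; an up step after a down step creates
-- one at the current position, a return if the height is 0.

vanishing : ∀ a → 𝟘 ⊕ 𝟘 ≋ 𝟘 ⊕ a ⊗ 𝟘
vanishing = solve-∀ ℤ[q]

extend-down : ∀ r h t V x →
  extensions r h true t V x ≋ stateWeight r (suc h) false t V ⊕ stateWeight r (suc h) true t V
extend-down r h (tip false zero    d) V x = ≋-refl
extend-down r h (tip false (suc m) d) V x = ≋-refl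
extend-down r h (tip true  zero    false) V x = ≋-refl
extend-down r h (tip true  zero    true)  V x = ≋-refl
extend-down r h (tip true  (suc m) d) V x with m ≡ᵇ h
extend-down r h (tip true (suc m) false) V x | true  = ≋-sym (+-identityʳ (markedWeight r V))
extend-down r h (tip true (suc m) true)  V x | true  = ≋-refl
extend-down r h (tip true (suc m) false) V x | false = ≋-refl
extend-down r h (tip true (suc m) true)  V x | false = ≋-refl

extend-up : ∀ r h t V x →
  extensions r (suc (suc h)) false t V x ≋ stateWeight r (suc h) false t V ⊕ q^ x ⊗ stateWeight r (suc h) true t V
extend-up r h (tip false zero    d)     V x = vanishing (q^ x)
extend-up r h (tip false (suc m) d)     V x = vanishing (q^ x)
extend-up r h (tip true  zero    false) V x = vanishing (q^ x)
extend-up r h (tip true  zero    true)  V x = vanishing (q^ x)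
extend-up r h (tip true  (suc m) d)     V x with m ≡ᵇ h
extend-up r h (tip true (suc m) false) V x | true  =
  ≋-trans (+-identityʳ _) (≋-sym (≋-trans (+-cong (≋-refl {markedWeight r V}) (*-zeroʳ (q^ x))) (+-identityʳ _)))
extend-up r h (tip true (suc m) true)  V x | true  = ≋-trans (+-identityʳ _) (weight-valley r V x m)
extend-up r h (tip true (suc m) false) V x | false = vanishing (q^ x)
extend-up r h (tip true (suc m) true)  V x | false = vanishing (q^ x)

atPred-vanishing : ∀ r a → 𝟘 ≋ atPred r (λ _ → a ⊗ 𝟘)
atPred-vanishing zero    a = ≋-refl
atPred-vanishing (suc r) a = ≋-sym (*-zeroʳ a)

extend-up-from-axis : ∀ r j t V x → x ≡ j + j →
  extensions r 1 false t V x
    ≋ (stateWeight r 0 false t V ⊕ q^ x ⊗ stateWeight r 0 true t V)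
        ⊕ atPred r (λ r' → q^ j ⊗ stateWeight r' 0 true t V)
extend-up-from-axis r j (tip ok h d) V x x≡2j = from-tip ok h d
  where
  zeros : 𝟘 ⊕ 𝟘 ≋ (𝟘 ⊕ q^ x ⊗ 𝟘) ⊕ atPred r (λ _ → q^ j ⊗ 𝟘)
  zeros = ≋-trans (vanishing (q^ x)) (≋-trans (≋-sym (+-identityʳ _)) (+-cong ≋-refl (atPred-vanishing r (q^ j))))
  from-tip : ∀ ok h d → extensions r 1 false (tip ok h d) V x
    ≋ (stateWeight r 0 false (tip ok h d) V ⊕ q^ x ⊗ stateWeight r 0 true (tip ok h d) V)
        ⊕ atPred r (λ r' → q^ j ⊗ stateWeight r' 0 true (tip ok h d) V)
  from-tip false zero    d     = zeros
  from-tip false (suc h) d     = zeros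
  from-tip true  (suc h) false = zeros
  from-tip true  (suc h) true  = zeros
  from-tip true  zero    false = ≋-trans (+-identityʳ _)
    (≋-sym (≋-trans (+-cong (≋-trans (+-cong (≋-refl {markedWeight r V}) (*-zeroʳ (q^ x))) (+-identityʳ _))
                            (≋-sym (atPred-vanishing r (q^ j))))
                    (+-identityʳ _)))
  from-tip true  zero    true  rewrite x≡2j = ≋-trans (+-identityʳ _) (weight-return r V j)

extend-up-to-axis : ∀ r t V x → extensions r 0 false t V x ≋ 𝟘
extend-up-to-axis r (tip false zero    d) V x = ≋-refl
extend-up-to-axis r (tip false (suc h) d) V x = ≋-refl
extend-up-to-axis r (tip true  zero    d) V x = ≋-refl
extend-up-to-axis r (tip true  (suc h) d) V x = ≋-refl

prefix-down : ∀ r n h → prefixGF r (suc n) h true ≋ prefixGF r n (suc h) false ⊕ prefixGF r n (suc h) true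
prefix-down r n h =
  ≋-trans (transfer r n h true (λ t V → stateWeight r (suc h) false t V ⊕ stateWeight r (suc h) true t V)
                    (λ t V → extend-down r h t V n))
          (Σ-+ (allSeqs n) _ _)

-- An up step to height h + 2 ≥ 2: a valley at height h + 1 when the
-- prefix ended with a down step.
prefix-up : ∀ r n h →
  prefixGF r (suc n) (suc (suc h)) false ≋ prefixGF r n (suc h) false ⊕ q^ n ⊗ prefixGF r n (suc h) true
prefix-up r n h =
  ≋-trans (transfer r n (suc (suc h)) false
                    (λ t V → stateWeight r (suc h) false t V ⊕ q^ n ⊗ stateWeight r (suc h) true t V)
                    (λ t V → extend-up r h t V n))
  (≋-trans (Σ-+ (allSeqs n) _ _)
           (+-cong (≋-refl {prefixGF r n (suc h) false}) (Σ-* (allSeqs n) (q^ n) _)))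

-- An up step from the axis after a down step creates a return, which may
-- be marked.
prefix-up-from-axis : ∀ r n j → n ≡ j + j →
  prefixGF r (suc n) 1 false
    ≋ (prefixGF r n 0 false ⊕ q^ n ⊗ prefixGF r n 0 true) ⊕ atPred r (λ r' → q^ j ⊗ prefixGF r' n 0 true)
prefix-up-from-axis r n j n≡2j =
  ≋-trans (transfer r n 1 false _ (λ t V → extend-up-from-axis r j t V n n≡2j))
  (≋-trans (Σ-+ (allSeqs n) _ _)
  (+-cong (≋-trans (Σ-+ (allSeqs n) _ _) (+-cong (≋-refl {prefixGF r n 0 false}) (Σ-* (allSeqs n) (q^ n) _)))
          (≋-trans (Σ-atPred (allSeqs n) r (λ w r' → q^ j ⊗ stateWeight r' 0 true (tipOf w) (valleys w)))
                   (atPred-cong r (λ r' → Σ-* (allSeqs n) (q^ j) _)))))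

prefix-up-to-axis : ∀ r n → prefixGF r (suc n) 0 false ≋ 𝟘
prefix-up-to-axis r n =
  ≋-trans (transfer r n 0 false (λ _ _ → 𝟘) (λ t V → extend-up-to-axis r t V n)) (Σ-zero (allSeqs n))

closed-weight : ∀ r t V →
  (if does (closed t Bool.≟ true) then markedWeight r V else 𝟘)
    ≋ stateWeight r 0 true t V ⊕ stateWeight r 0 false t V
closed-weight r (tip false h       d)     V = ≋-refl
closed-weight r (tip true  zero    true)  V = ≋-sym (+-identityʳ (markedWeight r V))
closed-weight r (tip true  zero    false) V = ≋-refl
closed-weight r (tip true  (suc h) true)  V = ≋-refl
closed-weight r (tip true  (suc h) false) V = ≋-refl

vmrGF-prefixGF : ∀ s r → vmrGF s r ≋ prefixGF r (2 * s) 0 true ⊕ prefixGF r (2 * s) 0 false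
vmrGF-prefixGF s r = begin
  vmrGF s r
    ≡⟨ Σ-foldr (E s r) (λ m → qpow (vmr m)) ⟩
  Σ (E s r) (λ m → qpow (vmr m))
    ≈⟨ Σ-concatMap (λ D → map (D ,ₘ_) (choose r (returns D))) (dyckPaths s) (λ m → qpow (vmr m)) ⟩
  Σ (dyckPaths s) (λ D → Σ (map (D ,ₘ_) (choose r (returns D))) (λ m → qpow (vmr m)))
    ≈⟨ Σ-cong (dyckPaths s) path-weight ⟩
  Σ (dyckPaths s) (λ D → markedWeight r (valleys D))
    ≈⟨ Σ-filter (λ w → isDyck w Bool.≟ true) (allSeqs (2 * s)) (λ D → markedWeight r (valleys D)) ⟩
  Σ (allSeqs (2 * s)) (λ w → if does (isDyck w Bool.≟ true) then markedWeight r (valleys w) else 𝟘)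
    ≈⟨ Σ-cong (allSeqs (2 * s)) filtered-weight ⟩
  Σ (allSeqs (2 * s)) (λ w → stateWeight r 0 true (tipOf w) (valleys w) ⊕ stateWeight r 0 false (tipOf w) (valleys w))
    ≈⟨ Σ-+ (allSeqs (2 * s)) _ _ ⟩
  prefixGF r (2 * s) 0 true ⊕ prefixGF r (2 * s) 0 false
    ∎
  where
  open ≋-Reasoning
  path-weight : ∀ D → Σ (map (D ,ₘ_) (choose r (returns D))) (λ m → qpow (vmr m)) ≋ markedWeight r (valleys D)
  path-weight D = ≋-trans (≋-reflexive (Σ-map (D ,ₘ_) (choose r (returns D)) (λ m → qpow (vmr m))))
                          (Σ-cong (choose r (returns D)) (λ c → ≋-sym (q^≋qpow _)))
  filtered-weight : ∀ w → (if does (isDyck w Bool.≟ true) then markedWeight r (valleys w) else 𝟘)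
                          ≋ stateWeight r 0 true (tipOf w) (valleys w) ⊕ stateWeight r 0 false (tipOf w) (valleys w)
  filtered-weight w =
    subst (λ b → (if does (b Bool.≟ true) then markedWeight r (valleys w) else 𝟘)
                   ≋ stateWeight r 0 true (tipOf w) (valleys w) ⊕ stateWeight r 0 false (tipOf w) (valleys w))
          (sym (isDyck-closed w)) (closed-weight r (tipOf w) (valleys w))

-- Vanishing: a prefix cannot end above its length, and a prefix of length
-- h + 2j ending at height h has fewer than j returns (fewer than j + 1 if
-- it ends with an up step), so with r ≥ j marks nothing survives.

zero-sum : ∀ {a x y} → x ≋ 𝟘 → y ≋ 𝟘 → x ⊕ a ⊗ y ≋ 𝟘
zero-sum {a} x≋0 y≋0 = ≋-trans (+-cong x≋0 (*-congʳ a y≋0)) (*-zeroʳ a)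

prefix-above-length : ∀ r n h d → n < h → prefixGF r n h d ≋ 𝟘
prefix-above-length r zero    (suc h)       true  _ = ≋-refl
prefix-above-length r zero    (suc h)       false _ = ≋-refl
prefix-above-length r (suc n) (suc h)       true  (s≤s n<h) =
  ≋-trans (prefix-down r n (suc h))
          (+-cong (prefix-above-length r n (suc (suc h)) false n<h+2) (prefix-above-length r n (suc (suc h)) true n<h+2))
  where n<h+2 = ℕP.m<n⇒m<1+n (ℕP.m<n⇒m<1+n n<h)
prefix-above-length r (suc n) (suc (suc h)) false (s≤s n<h) =
  ≋-trans (prefix-up r n h)
          (zero-sum {q^ n} (prefix-above-length r n (suc h) false n<h) (prefix-above-length r n (suc h) true n<h))

length-step : ∀ h j → h + (suc j + suc j) ≡ suc (suc (h + (j + j)))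
length-step = ℕ-solve

mutual
  prefix-few-returns-down : ∀ r n h j → j ≤ r → n ≡ h + (j + j) → prefixGF r n h true ≋ 𝟘
  prefix-few-returns-down r zero    h j       _   _   = ≋-refl
  prefix-few-returns-down r (suc n) h zero    _   eq  =
    ≋-trans (prefix-down r n h)
            (+-cong (prefix-above-length r n (suc h) false n<h+1) (prefix-above-length r n (suc h) true n<h+1))
    where n<h+1 = s≤s (ℕP.≤-trans (ℕP.n≤1+n n) (ℕP.≤-reflexive (trans eq (ℕP.+-identityʳ h))))
  prefix-few-returns-down r (suc n) h (suc j) j<r eq =
    ≋-trans (prefix-down r n h)
            (+-cong (prefix-few-returns-up r n h j j<r eq′)
                    (prefix-few-returns-down r n (suc h) j (ℕP.≤-trans (ℕP.n≤1+n j) j<r) eq′))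
    where eq′ = ℕP.suc-injective (trans eq (length-step h j))

  prefix-few-returns-up : ∀ r n h j → j < r → n ≡ suc h + (j + j) → prefixGF r n (suc h) false ≋ 𝟘
  prefix-few-returns-up r (suc n) (suc h) j j<r eq =
    ≋-trans (prefix-up r n h)
            (zero-sum {q^ n} (prefix-few-returns-up r n h j j<r (ℕP.suc-injective eq))
                             (prefix-few-returns-down r n (suc h) j (ℕP.<⇒≤ j<r) (ℕP.suc-injective eq)))
  prefix-few-returns-up (suc r) (suc n) zero j (s≤s j≤r) eq =
    ≋-trans (prefix-up-from-axis (suc r) n j (ℕP.suc-injective eq))
            (+-cong (zero-sum {q^ n} (no-final-up-step n)
                                     (prefix-few-returns-down (suc r) n 0 j (ℕP.m≤n⇒m≤1+n j≤r) (ℕP.suc-injective eq)))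
                    (≋-trans (*-congʳ (q^ j) (prefix-few-returns-down r n 0 j j≤r (ℕP.suc-injective eq)))
                             (*-zeroʳ (q^ j))))
    where
    no-final-up-step : ∀ n → prefixGF (suc r) n 0 false ≋ 𝟘
    no-final-up-step zero    = ≋-refl
    no-final-up-step (suc n) = prefix-up-to-axis (suc r) n

-- With T_r = r(r+1)/2, a prefix of length N+1 ending at
-- height h with h + 2(r + t) = N + 1 has generating function
--   down-step ending: q^T_r ([N, t-1] - q^(r+1) [N, t-2])
--   up-step ending:   q^T_r (q^t [N, t] - q^(r+t) [N, t-1])
-- independently of h.

triangle : ℕ → ℕ
triangle zero    = 0
triangle (suc r) = triangle r + suc r

gaussPred₂ : ℕ → ℕ → Poly
gaussPred₂ n zero    = []
gaussPred₂ n (suc k) = gaussPred n k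

downForm : ℕ → ℕ → ℕ → Poly
downForm N r t = q^ triangle r ⊗ (gaussPred N t ⊕ ⊖ (q^ suc r ⊗ gaussPred₂ N t))

upForm : ℕ → ℕ → ℕ → Poly
upForm N r t = q^ triangle r ⊗ (q^ t ⊗ gauss N t ⊕ ⊖ (q^ (r + t) ⊗ gaussPred N t))

downForm-zero : ∀ N r → downForm N r 0 ≋ 𝟘
downForm-zero N r = identity (q^ triangle r) (q^ suc r)
  where
  identity : ∀ c b → c ⊗ (𝟘 ⊕ ⊖ (b ⊗ 𝟘)) ≋ 𝟘
  identity = solve-∀ ℤ[q]

-- The closed forms satisfy the transfer recurrences.  Each identity is a
-- linear combination of the two Pascal rules and power laws.

downForm-step : ∀ N r t → downForm (suc N) r (suc t) ≋ upForm N r t ⊕ downForm N r t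
downForm-step N r zero = identity (q^ triangle r) (q^ suc r) (q^ (r + 0))
  where
  identity : ∀ c b J → c ⊗ (𝟙 ⊕ ⊖ (b ⊗ 𝟘)) ≋ c ⊗ (𝟙 ⊗ 𝟙 ⊕ ⊖ (J ⊗ 𝟘)) ⊕ c ⊗ (𝟘 ⊕ ⊖ (b ⊗ 𝟘))
  identity = solve-∀ ℤ[q]
downForm-step N r (suc t) =
  linear-combination (identity (q^ triangle r) (gauss N t) (gauss N (suc t)) (q^ suc t) (q^ suc r)
                               (gauss (suc N) t) (gaussPred N t) (q^ t) (q^ (r + suc t)))
    (+-cong (*-congʳ (q^ triangle r ⊗ q^ suc r) (≋-sym (pascal N t)))
            (*-congʳ (q^ triangle r ⊗ gauss N t) power))
  where
  power : q^ (r + suc t) ≋ q^ suc r ⊗ q^ t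
  power = ≋-trans (q^-cong (ℕP.+-suc r t)) (q^-+ (suc r) t)
  identity : ∀ c A B a b Y M e J →
    (c ⊗ ((A ⊕ a ⊗ B) ⊕ ⊖ (b ⊗ Y))) ⊕ ((c ⊗ b) ⊗ Y ⊕ (c ⊗ A) ⊗ (b ⊗ e))
      ≋ (c ⊗ (a ⊗ B ⊕ ⊖ (J ⊗ A)) ⊕ c ⊗ (A ⊕ ⊖ (b ⊗ M))) ⊕ ((c ⊗ b) ⊗ (M ⊕ e ⊗ A) ⊕ (c ⊗ A) ⊗ J)
  identity = solve-∀ ℤ[q]

upForm-step : ∀ N r t → upForm (suc N) r t ≋ upForm N r t ⊕ q^ suc N ⊗ downForm N r t
upForm-step N r zero = identity (q^ triangle r) (q^ (r + 0)) (q^ suc N) (q^ suc r)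
  where
  identity : ∀ c J S b → c ⊗ (𝟙 ⊗ 𝟙 ⊕ ⊖ (J ⊗ 𝟘)) ≋ c ⊗ (𝟙 ⊗ 𝟙 ⊕ ⊖ (J ⊗ 𝟘)) ⊕ S ⊗ (c ⊗ (𝟘 ⊕ ⊖ (b ⊗ 𝟘)))
  identity = solve-∀ ℤ[q]
upForm-step N r (suc t) =
  linear-combination (identity c a Z B S A J Y e M b)
    (+-cong (*-congʳ c (dual-pascal N (suc t)))
            (+-cong (*-congʳ (c ⊗ (Y ⊕ ⊖ A)) (≋-sym power)) (*-congʳ (c ⊗ b) (≋-sym (dual-pascal N t)))))
  where
  c = q^ triangle r
  a = q^ suc t
  Z = gauss (suc N) (suc t)
  B = gauss N (suc t)
  S = q^ suc N
  A = gauss N t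
  J = q^ (r + suc t)
  Y = gauss (suc N) t
  e = q^ t
  M = gaussPred N t
  b = q^ suc r
  power : J ≋ b ⊗ e
  power = ≋-trans (q^-cong (ℕP.+-suc r t)) (q^-+ (suc r) t)
  identity : ∀ c a Z B S A J Y e M b →
    (c ⊗ (a ⊗ Z ⊕ ⊖ (J ⊗ Y))) ⊕ (c ⊗ (a ⊗ B ⊕ S ⊗ A) ⊕ ((c ⊗ (Y ⊕ ⊖ A)) ⊗ J ⊕ (c ⊗ b) ⊗ (e ⊗ Y)))
      ≋ (c ⊗ (a ⊗ B ⊕ ⊖ (J ⊗ A)) ⊕ S ⊗ (c ⊗ (A ⊕ ⊖ (b ⊗ M))))
          ⊕ (c ⊗ (a ⊗ Z) ⊕ ((c ⊗ (Y ⊕ ⊖ A)) ⊗ (b ⊗ e) ⊕ (c ⊗ b) ⊗ (e ⊗ A ⊕ S ⊗ M)))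
  identity = solve-∀ ℤ[q]

-- For an up step leaving the axis the new return may be marked, which
-- couples the closed forms for r + 1 and r marks.
upForm-step-from-axis : ∀ N r t →
  upForm (suc N) (suc r) t ≋ q^ suc N ⊗ downForm N (suc r) t ⊕ q^ (suc r + t) ⊗ downForm N r (suc t)
upForm-step-from-axis N r zero =
  linear-combination (identity (q^ triangle (suc r)) (q^ triangle r) (q^ suc r) (q^ (suc r + 0))
                               (q^ suc N) (q^ suc (suc r)))
    (+-cong (*-congʳ 𝟙 (q^-+ (triangle r) (suc r))) (*-congʳ (q^ triangle r) (q^-cong (sym (ℕP.+-identityʳ (suc r))))))
  where
  identity : ∀ cr c g J S b →
    (cr ⊗ (𝟙 ⊗ 𝟙 ⊕ ⊖ (J ⊗ 𝟘))) ⊕ (𝟙 ⊗ (c ⊗ g) ⊕ c ⊗ J)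
      ≋ (S ⊗ (cr ⊗ (𝟘 ⊕ ⊖ (b ⊗ 𝟘))) ⊕ J ⊗ (c ⊗ (𝟙 ⊕ ⊖ (g ⊗ 𝟘)))) ⊕ (𝟙 ⊗ cr ⊕ c ⊗ g)
  identity = solve-∀ ℤ[q]
upForm-step-from-axis N r (suc t) =
  linear-combination (identity cr c g a Z B S A J Y e M b)
    (+-cong (*-congʳ cr (dual-pascal N (suc t)))
    (+-cong (*-congʳ (a ⊗ B ⊕ ⊖ (J ⊗ A)) (q^-+ (triangle r) (suc r)))
    (+-cong (*-congʳ (⊖ (c ⊗ B)) (q^-+ (suc r) (suc t)))
    (+-cong (*-congʳ (⊖ (cr ⊗ (Y ⊕ ⊖ A))) power)
            (*-congʳ (⊖ (cr ⊗ b)) (dual-pascal N t))))))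
  where
  cr = q^ triangle (suc r)
  c  = q^ triangle r
  g  = q^ suc r
  a  = q^ suc t
  Z  = gauss (suc N) (suc t)
  B  = gauss N (suc t)
  S  = q^ suc N
  A  = gauss N t
  J  = q^ (suc r + suc t)
  Y  = gauss (suc N) t
  e  = q^ t
  M  = gaussPred N t
  b  = q^ suc (suc r)
  power : J ≋ b ⊗ e
  power = ≋-trans (q^-cong (ℕP.+-suc (suc r) t)) (q^-+ (suc (suc r)) t)
  identity : ∀ cr c g a Z B S A J Y e M b →
    (cr ⊗ (a ⊗ Z ⊕ ⊖ (J ⊗ Y)))
      ⊕ (cr ⊗ (a ⊗ B ⊕ S ⊗ A) ⊕ ((a ⊗ B ⊕ ⊖ (J ⊗ A)) ⊗ (c ⊗ g) ⊕ ((⊖ (c ⊗ B)) ⊗ (g ⊗ a)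
           ⊕ ((⊖ (cr ⊗ (Y ⊕ ⊖ A))) ⊗ (b ⊗ e) ⊕ (⊖ (cr ⊗ b)) ⊗ (e ⊗ A ⊕ S ⊗ M)))))
    ≋ ((S ⊗ (cr ⊗ (A ⊕ ⊖ (b ⊗ M)))) ⊕ (J ⊗ (c ⊗ (B ⊕ ⊖ (g ⊗ A)))))
      ⊕ (cr ⊗ (a ⊗ Z) ⊕ ((a ⊗ B ⊕ ⊖ (J ⊗ A)) ⊗ cr ⊕ ((⊖ (c ⊗ B)) ⊗ J
           ⊕ ((⊖ (cr ⊗ (Y ⊕ ⊖ A))) ⊗ J ⊕ (⊖ (cr ⊗ b)) ⊗ (e ⊗ Y)))))
  identity = solve-∀ ℤ[q]

-- With no marks, leaving the axis at length N + 1 = 2(t+1) uses the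
-- symmetry [2t+1, t+1] = [2t+1, t].
upForm-step-from-axis₀ : ∀ N t → suc N ≡ suc t + suc t → upForm (suc N) 0 (suc t) ≋ q^ suc N ⊗ downForm N 0 (suc t)
upForm-step-from-axis₀ N t length≡ =
  linear-combination (identity q e Z B S A Y M)
    (+-cong (dual-pascal N (suc t))
            (+-cong (*-congʳ (q ⊗ e) symmetric) (*-congʳ (⊖ q) (dual-pascal N t))))
  where
  e = q^ t
  Z = gauss (suc N) (suc t)
  B = gauss N (suc t)
  S = q^ suc N
  A = gauss N t
  Y = gauss (suc N) t
  M = gaussPred N t
  symmetric : B ≋ A
  symmetric = subst (λ m → gauss m (suc t) ≋ gauss m t)
                    (sym (trans (ℕP.suc-injective length≡) (ℕP.+-suc t t)))
                    (gauss-symm (suc t) t)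
  identity : ∀ x e Z B S A Y M →
    (𝟙 ⊗ ((x ⊗ e) ⊗ Z ⊕ ⊖ ((x ⊗ e) ⊗ Y))) ⊕ (((x ⊗ e) ⊗ B ⊕ S ⊗ A) ⊕ ((x ⊗ e) ⊗ A ⊕ (⊖ x) ⊗ (e ⊗ A ⊕ S ⊗ M)))
      ≋ (S ⊗ (𝟙 ⊗ (A ⊕ ⊖ ((x ⊗ 𝟙) ⊗ M)))) ⊕ ((x ⊗ e) ⊗ Z ⊕ ((x ⊗ e) ⊗ B ⊕ (⊖ x) ⊗ (e ⊗ Y)))
  identity = solve-∀ ℤ[q]

length-step₂ : ∀ h r t → h + ((r + suc t) + (r + suc t)) ≡ suc (suc (h + ((r + t) + (r + t))))
length-step₂ = ℕ-solve

mutual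
  prefix-closed-down : ∀ r N h t → suc N ≡ h + ((r + t) + (r + t)) →
                       prefixGF r (suc N) h true ≋ downForm N r t
  prefix-closed-down r N h zero eq =
    ≋-trans (prefix-few-returns-down r (suc N) h r ℕP.≤-refl
                                     (subst (λ x → suc N ≡ h + (x + x)) (ℕP.+-identityʳ r) eq))
            (≋-sym (downForm-zero N r))
  prefix-closed-down r zero h (suc t) eq with () ← ℕP.suc-injective (trans eq (length-step₂ h r t))
  prefix-closed-down r (suc M) h (suc t) eq =
    ≋-trans (prefix-down r (suc M) h)
    (≋-trans (+-cong (prefix-closed-up r M h t eq′) (prefix-closed-down r M (suc h) t eq′))
             (≋-sym (downForm-step M r t)))
    where eq′ = ℕP.suc-injective (trans eq (length-step₂ h r t))

  prefix-closed-up : ∀ r N h t → suc N ≡ suc h + ((r + t) + (r + t)) →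
                     prefixGF r (suc N) (suc h) false ≋ upForm N r t
  prefix-closed-up r zero (suc h) t ()
  prefix-closed-up r (suc M) (suc h) t eq =
    ≋-trans (prefix-up r (suc M) h)
    (≋-trans (+-cong (prefix-closed-up r M h t (ℕP.suc-injective eq))
                     (*-congʳ (q^ suc M) (prefix-closed-down r M (suc h) t (ℕP.suc-injective eq))))
             (≋-sym (upForm-step M r t)))
  prefix-closed-up zero zero zero zero refl =
    ≋-trans (prefix-up-from-axis 0 0 0 refl) identity
    where
    identity : (((𝟙 ⊕ 𝟘) ⊕ 𝟘) ⊕ 𝟙 ⊗ (𝟘 ⊕ 𝟘)) ⊕ 𝟘 ≋ 𝟙 ⊗ (𝟙 ⊗ 𝟙 ⊕ ⊖ (𝟙 ⊗ 𝟘))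
    identity = solve-∀ ℤ[q]
  prefix-closed-up zero (suc M) zero zero ()
  prefix-closed-up zero (suc M) zero (suc t) eq =
    ≋-trans (prefix-up-from-axis 0 (suc M) (suc t) (ℕP.suc-injective eq))
    (≋-trans (+-identityʳ _)
    (≋-trans (+-cong (prefix-up-to-axis 0 M) (*-congʳ (q^ suc M) (prefix-closed-down 0 M 0 (suc t) (ℕP.suc-injective eq))))
             (≋-sym (upForm-step-from-axis₀ M t (ℕP.suc-injective eq)))))
  prefix-closed-up (suc r) (suc M) zero t eq =
    ≋-trans (prefix-up-from-axis (suc r) (suc M) (suc r + t) (ℕP.suc-injective eq))
    (≋-trans (+-cong (+-cong (prefix-up-to-axis (suc r) M)
                             (*-congʳ (q^ suc M) (prefix-closed-down (suc r) M 0 t (ℕP.suc-injective eq))))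
                     (*-congʳ (q^ (suc r + t)) (prefix-closed-down r M 0 (suc t) eq′)))
             (≋-sym (upForm-step-from-axis M r t)))
    where eq′ = subst (λ x → suc M ≡ x + x) (sym (ℕP.+-suc r t)) (ℕP.suc-injective eq)

-- Both Pascal rules express [N+1, a] through [N, a] and [N, a-1].
downForm-cleared : ∀ N r a → suc N ≡ (suc r + a) + (suc r + a) →
  (𝟙 ⊕ ⊖ q^ (suc r + a)) ⊗ downForm N r (suc a) ≋ q^ triangle r ⊗ (𝟙 ⊕ ⊖ q^ suc r) ⊗ gauss (suc N) a
downForm-cleared N r a length≡ = begin
  (𝟙 ⊕ ⊖ q^ (suc r + a)) ⊗ (c ⊗ (Y ⊕ ⊖ (b ⊗ X)))
    ≈⟨ *-congˡ (c ⊗ (Y ⊕ ⊖ (b ⊗ X))) (one-minus-cong (q^-+ (suc r) a)) ⟩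
  (𝟙 ⊕ ⊖ (b ⊗ A)) ⊗ (c ⊗ (Y ⊕ ⊖ (b ⊗ X)))
    ≈⟨ expand c b A X Y ⟩
  c ⊗ (Y ⊕ ((b ⊗ A) ⊗ b) ⊗ X) ⊕ ⊖ (c ⊗ b ⊗ (X ⊕ A ⊗ Y))
    ≈⟨ +-cong (*-congʳ c dual) (neg-cong (*-congʳ (c ⊗ b) (pascal N a))) ⟨
  c ⊗ Z ⊕ ⊖ (c ⊗ b ⊗ Z)
    ≈⟨ factor c b Z ⟩
  c ⊗ (𝟙 ⊕ ⊖ b) ⊗ Z
    ∎
  where
  open ≋-Reasoning
  c = q^ triangle r
  b = q^ suc r
  A = q^ a
  X = gaussPred N a
  Y = gauss N a
  Z = gauss (suc N) a
  exponent : suc N ≡ a + ((suc r + a) + suc r)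
  exponent = trans length≡ (rearrange r a)
    where
    rearrange : ∀ r a → (suc r + a) + (suc r + a) ≡ a + ((suc r + a) + suc r)
    rearrange = ℕ-solve
  power : q^ suc N ≋ A ⊗ ((b ⊗ A) ⊗ b)
  power = ≋-trans (q^-cong exponent)
          (≋-trans (q^-+ a ((suc r + a) + suc r))
                   (*-congʳ A (≋-trans (q^-+ (suc r + a) (suc r)) (*-congˡ b (q^-+ (suc r) a)))))
  dual : Z ≋ Y ⊕ ((b ⊗ A) ⊗ b) ⊗ X
  dual = q^-cancel a (≋-trans (dual-pascal N a)
           (≋-trans (+-cong (≋-refl {A ⊗ Y}) (*-congˡ X power)) (distribute A Y ((b ⊗ A) ⊗ b) X)))
    where
    distribute : ∀ A Y P X → A ⊗ Y ⊕ (A ⊗ P) ⊗ X ≋ A ⊗ (Y ⊕ P ⊗ X)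
    distribute = solve-∀ ℤ[q]
  expand : ∀ c b A X Y →
    (𝟙 ⊕ ⊖ (b ⊗ A)) ⊗ (c ⊗ (Y ⊕ ⊖ (b ⊗ X))) ≋ c ⊗ (Y ⊕ ((b ⊗ A) ⊗ b) ⊗ X) ⊕ ⊖ (c ⊗ b ⊗ (X ⊕ A ⊗ Y))
  expand = solve-∀ ℤ[q]
  factor : ∀ c b Z → c ⊗ Z ⊕ ⊖ (c ⊗ b ⊗ Z) ≋ c ⊗ (𝟙 ⊕ ⊖ b) ⊗ Z
  factor = solve-∀ ℤ[q]

triangle-C : ∀ r → triangle r ≡ (r + 1) C 2
triangle-C zero    = refl
triangle-C (suc r) = begin
  triangle r + suc r          ≡⟨ cong (_+ suc r) (triangle-C r) ⟩
  (r + 1) C 2 + suc r         ≡⟨ ℕP.+-comm ((r + 1) C 2) (suc r) ⟩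
  suc r + (r + 1) C 2         ≡⟨ cong (_+ (r + 1) C 2) (trans (ℕP.+-comm 1 r) (sym (nC1≡n (r + 1)))) ⟩
  (r + 1) C 1 + (r + 1) C 2   ≡⟨ nCk+nC[k+1]≡[n+1]C[k+1] (r + 1) 1 ⟩
  (suc r + 1) C 2             ∎
  where open ≡-Reasoning

qbinom-≤ : ∀ {n k} → k ≤ n → qbinom n k ≡ qPoch n ⁄ (qPoch k *ₚ qPoch (n ∸ k))
qbinom-≤ {n} {k} k≤n with k ≤ᵇ n | ℕP.≤⇒≤ᵇ k≤n
... | true | _ = refl

qbinom-> : ∀ {n k} → n < k → qbinom n k ≡ 0ₚ ⁄ 1ₚ
qbinom-> {n} {k} n<k with k ≤ᵇ n in k≤ᵇn
... | false = refl
... | true  = ⊥-elim (ℕP.<⇒≱ n<k (ℕP.≤ᵇ⇒≤ k n (subst T (sym k≤ᵇn) tt)))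

vmr-closed : ∀ r a → vmrGF (suc r + a) r ≋ downForm (ℕ.pred (2 * (suc r + a))) r (suc a)
vmr-closed r a =
  ≋-trans (vmrGF-prefixGF (suc r + a) r)
  (≋-trans (+-cong (prefix-closed-down r N 0 (suc a) (length≡ r a)) (prefix-up-to-axis r N))
           (+-identityʳ _))
  where
  N = ℕ.pred (2 * (suc r + a))
  length≡ : ∀ r a → 2 * (suc r + a) ≡ 0 + ((r + suc a) + (r + suc a))
  length≡ = ℕ-solve

vmr-many-marks : ∀ s r → suc s ≤ r → vmrGF (suc s) r ≋ 𝟘
vmr-many-marks s r s<r =
  ≋-trans (vmrGF-prefixGF (suc s) r)
          (+-cong (prefix-few-returns-down r (2 * suc s) 0 (suc s) s<r 2s≡s+s)
                  (prefix-up-to-axis r (s + suc (s + 0))))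
  where
  2s≡s+s : 2 * suc s ≡ 0 + (suc s + suc s)
  2s≡s+s = cong (λ m → suc s + m) (ℕP.+-identityʳ (suc s))

CorollaryStatement : ℕ → ℕ → Set
CorollaryStatement s r =
  poly (vmrGF s r)
    ≈f (poly (qpow ((r + 1) C 2)) *f ((1ₚ -ₚ qpow (r + 1)) ⁄ (1ₚ -ₚ qpow s)))
         *f qbinom (2 * s) (s + r + 1)

k+a≡2s : ∀ r a → (suc r + a) + r + 1 + a ≡ 2 * (suc r + a)
k+a≡2s = ℕ-solve

k≤2s : ∀ r a → (suc r + a) + r + 1 ≤ 2 * (suc r + a)
k≤2s r a = ℕP.≤-trans (ℕP.m≤m+n _ a) (ℕP.≤-reflexive (k+a≡2s r a))

2s∸k≡a : ∀ r a → 2 * (suc r + a) ∸ ((suc r + a) + r + 1) ≡ a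
2s∸k≡a r a = trans (cong (_∸ ((suc r + a) + r + 1)) (sym (k+a≡2s r a))) (ℕP.m+n∸m≡n ((suc r + a) + r + 1) a)

few-marks : ∀ r a → CorollaryStatement (suc r + a) r
few-marks r a rewrite qbinom-≤ (k≤2s r a) | 2s∸k≡a r a = coeff-≡ (begin
  vmrGF s r ⊗ ((𝟙 ⊗ (𝟙 ⊕ ⊖ qpow s)) ⊗ (qPoch k ⊗ qPoch a))
    ≈⟨ *-cong (vmr-closed r a) (*-congˡ (qPoch k ⊗ qPoch a) (*-congʳ 𝟙 (one-minus-cong (≋-sym (q^≋qpow s))))) ⟩
  D ⊗ ((𝟙 ⊗ (𝟙 ⊕ ⊖ q^ s)) ⊗ (qPoch k ⊗ qPoch a))
    ≈⟨ regroup (q^ s) D (qPoch k) (qPoch a) ⟩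
  ((𝟙 ⊕ ⊖ q^ s) ⊗ D) ⊗ (qPoch a ⊗ qPoch k)
    ≈⟨ *-congˡ (qPoch a ⊗ qPoch k) (downForm-cleared N r a (2s≡s+s r a)) ⟩
  (c ⊗ (𝟙 ⊕ ⊖ q^ suc r) ⊗ gauss (2 * s) a) ⊗ (qPoch a ⊗ qPoch k)
    ≈⟨ reassociate (c ⊗ (𝟙 ⊕ ⊖ q^ suc r)) (gauss (2 * s) a) (qPoch a) (qPoch k) ⟩
  (c ⊗ (𝟙 ⊕ ⊖ q^ suc r)) ⊗ (gauss (2 * s) a ⊗ qPoch a ⊗ qPoch k)
    ≈⟨ *-congʳ (c ⊗ (𝟙 ⊕ ⊖ q^ suc r)) factorial ⟩
  (c ⊗ (𝟙 ⊕ ⊖ q^ suc r)) ⊗ qPoch (2 * s)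
    ≈⟨ *-congˡ (qPoch (2 * s)) (*-cong coefficient (one-minus-cong power)) ⟩
  (qpow ((r + 1) C 2) ⊗ (𝟙 ⊕ ⊖ qpow (r + 1))) ⊗ qPoch (2 * s)
    ≈⟨ ≋-sym (*-identityʳ _) ⟩
  (qpow ((r + 1) C 2) ⊗ (𝟙 ⊕ ⊖ qpow (r + 1))) ⊗ qPoch (2 * s) ⊗ 𝟙
    ∎)
  where
  open ≋-Reasoning
  s = suc r + a
  k = s + r + 1
  N = ℕ.pred (2 * s)
  D = downForm N r (suc a)
  c = q^ triangle r
  2s≡s+s : ∀ r a → 2 * (suc r + a) ≡ (suc r + a) + (suc r + a)
  2s≡s+s = ℕ-solve
  factorial : gauss (2 * s) a ⊗ qPoch a ⊗ qPoch k ≋ qPoch (2 * s)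
  factorial = subst (λ n → gauss n a ⊗ qPoch a ⊗ qPoch k ≋ qPoch n)
                    (trans (ℕP.+-comm a k) (k+a≡2s r a)) (gauss-factorial a k)
  coefficient : c ≋ qpow ((r + 1) C 2)
  coefficient = ≋-trans (q^-cong (triangle-C r)) (q^≋qpow _)
  power : q^ suc r ≋ qpow (r + 1)
  power = ≋-trans (q^-cong (ℕP.+-comm 1 r)) (q^≋qpow (r + 1))
  regroup : ∀ S D P Q → D ⊗ ((𝟙 ⊗ (𝟙 ⊕ ⊖ S)) ⊗ (P ⊗ Q)) ≋ ((𝟙 ⊕ ⊖ S) ⊗ D) ⊗ (Q ⊗ P)
  regroup = solve-∀ ℤ[q]
  reassociate : ∀ C Z P Q → (C ⊗ Z) ⊗ (P ⊗ Q) ≋ C ⊗ (Z ⊗ P ⊗ Q)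
  reassociate = solve-∀ ℤ[q]

2s<k : ∀ s r → suc s ≤ r → 2 * suc s < suc s + r + 1
2s<k s r s<r = ℕP.≤-<-trans (ℕP.+-monoʳ-≤ (suc s) (ℕP.≤-trans (ℕP.≤-reflexive (ℕP.+-identityʳ (suc s))) s<r))
                            (ℕP.m<m+n (suc s + r) (s≤s z≤n))

many-marks : ∀ s r → suc s ≤ r → CorollaryStatement (suc s) r
many-marks s r s<r rewrite qbinom-> (2s<k s r s<r) =
  coeff-≡ (≋-trans (*-zeroˡ _ _ (≋-sym (vmr-many-marks s r s<r)))
                   (≋-sym (*-zeroˡ (c ⊗ 𝟘) 𝟙 (≋-sym (*-zeroʳ c)))))
  where
  c = qpow ((r + 1) C 2) ⊗ (𝟙 ⊕ ⊖ qpow (r + 1))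

corollary2p4 : (s r : ℕ) → 1 ≤ s →
    poly (vmrGF s r)
      ≈f (poly (qpow ((r + 1) C 2)) *f ((1ₚ -ₚ qpow (r + 1)) ⁄ (1ₚ -ₚ qpow s)))
           *f qbinom (2 * s) (s + r + 1)
corollary2p4 (suc s) r _ with r ℕP.<? suc s
... | yes r<s with (a , r+1+a≡s) ← ℕP.m≤n⇒∃[o]m+o≡n r<s =
  subst (λ s → CorollaryStatement s r) r+1+a≡s (few-marks r a)
... | no r≮s = many-marks s r (ℕP.≮⇒≥ r≮s)
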